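{- Let $t$ be a caterpillar tree on $n$ vertices with vertex degrees $k_1,\dots,k_n$. Then $$D_{min}^{t} = n-1+\sum_{i=1}^n \left\lfloor \frac{1}{4}(k_i-1)^2\right\rfloor = \sum_{i=1}^n \left\lfloor \frac{1}{4}(k_i+1)^2\right\rfloor - (n-1) = \frac{1}{4}\left(n\langle k^2\rangle + q\right),$$ where $\langle k^2\rangle=\frac1n\sum_{i=1}^n k_i^2$ and $q=\sum_{i=1}^n (k_i\bmod 2)$ is the number of vertices of odd degree.
   Context: A caterpillar tree is a tree such that removing all its leaves leaves a path (a linear tree, possibly a single vertex or empty). A linear arrangement of a tree on $n$ vertices is a bijection $\pi$ from its vertex set to $\{1,\dots,n\}$; $D(\pi)=\sum_{\{u,v\}\in E}|\pi(u)-\pi(v)|$, and $D_{min}^t$ is the minimum of $D(\pi)$ over all linear arrangements of $t$. -}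

module Defs where

open import Data.Nat using (ℕ; zero; suc; _+_; _*_; _∸_; _^_; _≤_; ∣_-_∣)
open import Data.Nat.DivMod using (_/_; _%_)
open import Data.Fin using (Fin; toℕ; _≟_)
open import Data.Fin.Permutation using (Permutation′; _⟨$⟩ʳ_)
open import Data.List using (List; []; _∷_; length; map; filter; allFin)
open import Data.Nat.ListAction using (sum)
open import Data.List.Membership.Propositional using (_∈_)
open import Data.List.Relation.Unary.AllPairs using (AllPairs)
open import Data.List.Relation.Unary.Unique.Propositional using (Unique)
open import Data.Product using (_×_; _,_; proj₁; proj₂; Σ; ∃)
open import Data.Sum using (_⊎_)
open import Relation.Nullary using (¬_)
open import Relation.Nullary.Decidable using (_⊎-dec_)
open import Relation.Binary.PropositionalEquality using (_≡_; _≢_)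
open import Relation.Binary.Construct.Closure.ReflexiveTransitive using (Star)

Edge : ℕ → Set
Edge n = Fin n × Fin n

Adj : ∀ {n} → List (Edge n) → Fin n → Fin n → Set
Adj E u v = ((u , v) ∈ E) ⊎ ((v , u) ∈ E)

SameEdge : ∀ {n} → Edge n → Edge n → Set
SameEdge (a , b) (c , d) = ((a ≡ c) × (b ≡ d)) ⊎ ((a ≡ d) × (b ≡ c))

Simple : ∀ {n} → List (Edge n) → Set
Simple E = (∀ {u v} → (u , v) ∈ E → u ≢ v) × AllPairs (λ e f → ¬ SameEdge e f) E

Connected : ∀ {n} → List (Edge n) → Set
Connected E = ∀ u v → Star (Adj E) u v

record Tree (n : ℕ) : Set where
  field
    edges     : List (Edge n)
    simple    : Simple edges
    connected : Connected edges
    size      : suc (length edges) ≡ n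

open Tree public

degree : ∀ {n} → Tree n → Fin n → ℕ
degree t v = length (filter (λ e → (proj₁ e ≟ v) ⊎-dec (proj₂ e ≟ v)) (edges t))

Leaf : ∀ {n} → Tree n → Fin n → Set
Leaf t v = degree t v ≡ 1

-- Caterpillar: removing all leaves leaves a path (possibly empty or a single
-- vertex): there is a duplicate-free listing of exactly the non-leaf vertices
-- such that two non-leaf vertices are adjacent iff they are consecutive.
data Consecutive {A : Set} : List A → A → A → Set where
  here  : ∀ {x y xs} → Consecutive (x ∷ y ∷ xs) x y
  there : ∀ {x xs a b} → Consecutive xs a b → Consecutive (x ∷ xs) a b

IsCaterpillar : ∀ {n} → Tree n → Set
IsCaterpillar {n} t = Σ (List (Fin n)) λ ps →
    Unique ps
  × (∀ v → (v ∈ ps → ¬ Leaf t v) × (¬ Leaf t v → v ∈ ps))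
  × (∀ u v → u ∈ ps → v ∈ ps →
       (Adj (edges t) u v → Consecutive ps u v ⊎ Consecutive ps v u)
     × (Consecutive ps u v ⊎ Consecutive ps v u → Adj (edges t) u v))

-- Linear arrangements: bijections Fin n → Fin n (positions 0..n-1 instead of
-- 1..n; only differences matter).
LinArr : ℕ → Set
LinArr n = Permutation′ n

D : ∀ {n} → Tree n → LinArr n → ℕ
D t π = sum (map (λ e → ∣ toℕ (π ⟨$⟩ʳ proj₁ e) - toℕ (π ⟨$⟩ʳ proj₂ e) ∣) (edges t))

IsDmin : ∀ {n} → Tree n → ℕ → Set
IsDmin {n} t d = (∃ λ (π : LinArr n) → D t π ≡ d) × (∀ (π : LinArr n) → d ≤ D t π)

sumDeg : ∀ {n} → Tree n → (ℕ → ℕ) → ℕ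
sumDeg {n} t f = sum (map (λ v → f (degree t v)) (allFin n))

module Submission where

-- The cost of an arrangement is the sum over edges of 1 + gap, where the gap of an edge counts
-- the vertices strictly between its endpoints. For an edge uv, the neighbours of u between u and v
-- and the neighbours of v between u and v are distinct because a caterpillar has no triangles.
-- Regrouping these counts by vertex, a vertex v with a neighbours on its left and b on its right
-- contributes the pairs of neighbours on a common side, C(a,2) + C(b,2) ≥ ⌊(k - 1)² / 4⌋ for
-- k = a + b. Listing the spine in order, with the leaves of each spine vertex placed alternately
-- just before and just after it, makes every vertex inside an edge adjacent to one of its
-- endpoints and splits every neighbourhood evenly, so both bounds are attained. The other two
-- expressions follow from Σ k = 2 (n - 1).

open import Data.Empty using (⊥-elim)
open import Data.Fin using (Fin; zero; suc; toℕ; fromℕ<; punchOut; _≟_)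
open import Data.Fin.Properties using (toℕ-injective; toℕ<n; toℕ-fromℕ<; any?; punchOut-injective; injective⇒≤)
open import Data.Fin.Permutation using (Permutation′; _⟨$⟩ʳ_; _⟨$⟩ˡ_; inverseˡ; inverseʳ; permutation; flip)
open import Data.List using (List; []; _∷_; _++_; map; filter; length; allFin; tabulate)
open import Data.List.Properties using (filter-all; filter-accept; filter-reject; filter-++; length-map; length-tabulate)
open import Data.List.Membership.Propositional using (_∈_; _∉_)
open import Data.List.Membership.Propositional.Properties using (∈-filter⁻; ∈-filter⁺; ∈-map⁺; ∈-map⁻; ∈-allFin; ∈-++⁺ˡ; ∈-++⁺ʳ)
open import Data.List.Relation.Unary.All as All using (All; []; _∷_)
open import Data.List.Relation.Unary.All.Properties using (all-filter)
open import Data.List.Relation.Unary.AllPairs using (AllPairs; []; _∷_)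
import Data.List.Relation.Unary.AllPairs.Properties as AllPairs
open import Data.List.Relation.Unary.Any using (here; there)
open import Data.List.Relation.Unary.Unique.Propositional using (Unique)
import Data.List.Relation.Unary.Unique.Propositional.Properties as Unique
open import Data.Nat hiding (_≟_)
open import Data.Nat.DivMod using (_/_; _%_; +-distrib-/-∣ʳ; m*n/n≡m)
open import Data.Nat.Divisibility using (n∣m*n)
open import Data.Nat.ListAction using (sum)
open import Data.Nat.Properties hiding (_≟_)
open import Data.Nat.Tactic.RingSolver using (solve-∀)
open import Data.Parity.Base using (Parity; 0ℙ; 1ℙ; _⁻¹)
open import Data.Parity.Properties using (⁻¹-selfInverse; ⁻¹-involutive; p≢p⁻¹; suc-homo-⁻¹)
open import Data.Product using (∃; _×_; _,_; proj₁; proj₂)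
open import Data.Sum using (_⊎_; inj₁; inj₂; [_,_]) renaming (map to ⊎-map)
open import Function using (_∘_)
open import Relation.Binary.Construct.Closure.ReflexiveTransitive using (Star; ε; _◅_)
open import Relation.Binary.Definitions using (DecidableEquality; tri<; tri≈; tri>)
open import Relation.Binary.PropositionalEquality using (_≡_; _≢_; refl; sym; trans; cong; cong₂; subst; subst₂; module ≡-Reasoning)
open import Relation.Nullary using (Dec; yes; no; ¬_)
open import Relation.Nullary.Decidable using (¬?; _×-dec_; _⊎-dec_)

open import Defs

import Data.Nat as ℕ

∑ : {A : Set} → List A → (A → ℕ) → ℕ
∑ xs f = sum (map f xs)

module _ {A : Set} where

  ∑-cong : (xs : List A) {f g : A → ℕ} → (∀ {x} → x ∈ xs → f x ≡ g x) → ∑ xs f ≡ ∑ xs g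
  ∑-cong []       eq = refl
  ∑-cong (x ∷ xs) eq = cong₂ _+_ (eq (here refl)) (∑-cong xs (eq ∘ there))

  ∑-mono-≤ : (xs : List A) {f g : A → ℕ} → (∀ {x} → x ∈ xs → f x ≤ g x) → ∑ xs f ≤ ∑ xs g
  ∑-mono-≤ []       le = z≤n
  ∑-mono-≤ (x ∷ xs) le = +-mono-≤ (le (here refl)) (∑-mono-≤ xs (le ∘ there))

  ∑-mono-< : {xs : List A} {a : A} (f g : A → ℕ) → (∀ {x} → x ∈ xs → f x ≤ g x) →
             a ∈ xs → f a < g a → ∑ xs f < ∑ xs g
  ∑-mono-< {x ∷ xs} f g le (here refl) lt  = +-mono-<-≤ lt (∑-mono-≤ xs (le ∘ there))
  ∑-mono-< {x ∷ xs} f g le (there a∈) lt = +-mono-≤-< (le (here refl)) (∑-mono-< f g (le ∘ there) a∈ lt)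

  ∑-distrib-+ : (xs : List A) (f g : A → ℕ) → ∑ xs (λ x → f x + g x) ≡ ∑ xs f + ∑ xs g
  ∑-distrib-+ []       f g = refl
  ∑-distrib-+ (x ∷ xs) f g = trans (cong (f x + g x +_) (∑-distrib-+ xs f g))
                                   (+-+-interchange (f x) (g x) (∑ xs f) (∑ xs g))
    where
      +-+-interchange : ∀ a b c d → (a + b) + (c + d) ≡ (a + c) + (b + d)
      +-+-interchange = solve-∀

  ∑-*-distribˡ : (xs : List A) (c : ℕ) (f : A → ℕ) → ∑ xs (λ x → c * f x) ≡ c * ∑ xs f
  ∑-*-distribˡ []       c f = sym (*-zeroʳ c)
  ∑-*-distribˡ (x ∷ xs) c f = trans (cong (c * f x +_) (∑-*-distribˡ xs c f))
                                    (sym (*-distribˡ-+ c (f x) (∑ xs f)))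

  ∑-++ : (xs ys : List A) (f : A → ℕ) → ∑ (xs ++ ys) f ≡ ∑ xs f + ∑ ys f
  ∑-++ []       ys f = refl
  ∑-++ (x ∷ xs) ys f = trans (cong (f x +_) (∑-++ xs ys f)) (sym (+-assoc (f x) _ _))

  ∑-zero : (xs : List A) {f : A → ℕ} → (∀ {x} → x ∈ xs → f x ≡ 0) → ∑ xs f ≡ 0
  ∑-zero []       eq = refl
  ∑-zero (x ∷ xs) eq = cong₂ _+_ (eq (here refl)) (∑-zero xs (eq ∘ there))

  ∑-one : (xs : List A) → ∑ xs (λ _ → 1) ≡ length xs
  ∑-one []       = refl
  ∑-one (x ∷ xs) = cong suc (∑-one xs)

  ∑-≤-length : (xs : List A) (f : A → ℕ) → (∀ {x} → x ∈ xs → f x ≤ 1) → ∑ xs f ≤ length xs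
  ∑-≤-length xs f le = ≤-trans (∑-mono-≤ xs le) (≤-reflexive (∑-one xs))

  ∑-single : {xs : List A} {a : A} (f : A → ℕ) → Unique xs → a ∈ xs →
             (∀ {x} → x ∈ xs → x ≢ a → f x ≡ 0) → ∑ xs f ≡ f a
  ∑-single {x ∷ xs} f (x∉ ∷ u) (here refl) zero-off =
    trans (cong (f x +_) (∑-zero xs (λ y∈ → zero-off (there y∈) (λ eq → All.lookup x∉ y∈ (sym eq)))))
          (+-identityʳ _)
  ∑-single {x ∷ xs} f (x∉ ∷ u) (there a∈) zero-off =
    cong₂ _+_ (zero-off (here refl) (All.lookup x∉ a∈)) (∑-single f u a∈ (zero-off ∘ there))

  ∑-pair : {xs : List A} {a b : A} (f : A → ℕ) → Unique xs → a ∈ xs → b ∈ xs → a ≢ b →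
           (∀ {x} → x ∈ xs → x ≢ a → x ≢ b → f x ≡ 0) → ∑ xs f ≡ f a + f b
  ∑-pair f (x∉ ∷ u) (here refl) (here refl) a≢b zero-off = ⊥-elim (a≢b refl)
  ∑-pair {x ∷ xs} f (x∉ ∷ u) (here refl) (there b∈) a≢b zero-off =
    cong (f x +_) (∑-single f u b∈ (λ y∈ → zero-off (there y∈) (λ eq → All.lookup x∉ y∈ (sym eq))))
  ∑-pair {x ∷ xs} {a} f (x∉ ∷ u) (there a∈) (here refl) a≢b zero-off =
    trans (cong (f x +_) (∑-single f u a∈ (λ y∈ y≢a → zero-off (there y∈) y≢a (λ eq → All.lookup x∉ y∈ (sym eq)))))
          (+-comm (f x) (f a))
  ∑-pair {x ∷ xs} f (x∉ ∷ u) (there a∈) (there b∈) a≢b zero-off =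
    cong₂ _+_ (zero-off (here refl) (All.lookup x∉ a∈) (All.lookup x∉ b∈))
              (∑-pair f u a∈ b∈ a≢b (zero-off ∘ there))

  ∑-partition : {P : A → Set} (P? : ∀ x → Dec (P x)) (xs : List A) (f : A → ℕ) →
                ∑ xs f ≡ ∑ (filter P? xs) f + ∑ (filter (¬? ∘ P?) xs) f
  ∑-partition P? []       f = refl
  ∑-partition P? (x ∷ xs) f with P? x
  ... | yes _ = trans (cong (f x +_) (∑-partition P? xs f)) (sym (+-assoc (f x) _ _))
  ... | no  _ = trans (cong (f x +_) (∑-partition P? xs f))
                      (+-left-comm (f x) (∑ (filter P? xs) f) (∑ (filter (¬? ∘ P?) xs) f))
    where
      +-left-comm : ∀ a b c → a + (b + c) ≡ b + (a + c)
      +-left-comm = solve-∀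

  ∑-nonzero : (xs : List A) (f : A → ℕ) → ∑ xs f ≡ ∑ (filter (λ x → ¬? (f x ℕ.≟ 0)) xs) f
  ∑-nonzero []       f = refl
  ∑-nonzero (x ∷ xs) f with f x ℕ.≟ 0
  ... | yes fx≡0 = trans (cong₂ _+_ fx≡0 (∑-nonzero xs f))
                         (cong (λ l → ∑ l f) (sym (filter-reject (λ x → ¬? (f x ℕ.≟ 0)) (λ ne → ne fx≡0))))
  ... | no  fx≢0 = trans (cong (f x +_) (∑-nonzero xs f))
                         (cong (λ l → ∑ l f) (sym (filter-accept (λ x → ¬? (f x ℕ.≟ 0)) fx≢0)))

∑-map : {A B : Set} (xs : List A) (h : A → B) (f : B → ℕ) → ∑ (map h xs) f ≡ ∑ xs (f ∘ h)
∑-map []       h f = refl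
∑-map (x ∷ xs) h f = cong (f (h x) +_) (∑-map xs h f)

module _ {A : Set} (_≟ᴬ_ : DecidableEquality A) where

  private
    remove : A → List A → List A
    remove y = filter (λ x → ¬? (x ≟ᴬ y))

    ∑-remove : {xs : List A} (y : A) (f : A → ℕ) → Unique xs → ∑ xs f ≤ f y + ∑ (remove y xs) f
    ∑-remove {[]}     y f u = z≤n
    ∑-remove {x ∷ xs} y f (x∉ ∷ u) with x ≟ᴬ y
    ... | yes refl = ≤-reflexive (cong (λ l → f x + ∑ l f)
                       (sym (filter-all (λ x → ¬? (x ≟ᴬ y)) (All.map (λ ne eq → ne (sym eq)) x∉))))
    ... | no  _    = ≤-trans (+-monoʳ-≤ (f x) (∑-remove y f u)) (≤-reflexive (+-left-comm (f x) (f y) _))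
      where
        +-left-comm : ∀ a b c → a + (b + c) ≡ b + (a + c)
        +-left-comm = solve-∀

  ∑-⊆ : {xs : List A} (ys : List A) (f : A → ℕ) → Unique xs → (∀ {x} → x ∈ xs → x ∈ ys) → ∑ xs f ≤ ∑ ys f
  ∑-⊆ {[]}     ys       f u sub = z≤n
  ∑-⊆ {x ∷ xs} []       f u sub with () ← sub (here refl)
  ∑-⊆ {xs}     (y ∷ ys) f u sub =
    ≤-trans (∑-remove y f u) (+-monoʳ-≤ (f y) (∑-⊆ ys f (Unique.filter⁺ _ u) sub′))
    where
      sub′ : ∀ {x} → x ∈ remove y xs → x ∈ ys
      sub′ x∈ with x∈xs , x≢y ← ∈-filter⁻ (λ x → ¬? (x ≟ᴬ y)) x∈ | sub x∈xs
      ... | here x≡y  = ⊥-elim (x≢y x≡y)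
      ... | there x∈ys = x∈ys

  ∑-support-⊆ : {xs : List A} (ys : List A) (f : A → ℕ) → Unique xs →
                (∀ {x} → x ∈ xs → f x ≢ 0 → x ∈ ys) → ∑ xs f ≤ ∑ ys f
  ∑-support-⊆ {xs} ys f u supp = ≤-trans (≤-reflexive (∑-nonzero xs f))
    (∑-⊆ ys f (Unique.filter⁺ _ u) (λ x∈ → let (x∈xs , fx≢0) = ∈-filter⁻ (λ x → ¬? (f x ℕ.≟ 0)) x∈ in supp x∈xs fx≢0))

  ∑-≤-1 : {xs : List A} (f : A → ℕ) → Unique xs → (∀ {x} → x ∈ xs → f x ≤ 1) →
          (∀ {x y} → x ∈ xs → y ∈ xs → f x ≢ 0 → f y ≢ 0 → x ≡ y) → ∑ xs f ≤ 1
  ∑-≤-1 {xs} f u le supp = ≤-trans (≤-reflexive (∑-nonzero xs f))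
    (≤-trans (∑-≤-length (filter nz? xs) f (λ x∈ → le (proj₁ (∈-filter⁻ nz? x∈))))
             (length≤1 (Unique.filter⁺ nz? u) (λ x∈ y∈ →
               let (x∈′ , fx≢0) = ∈-filter⁻ nz? x∈
                   (y∈′ , fy≢0) = ∈-filter⁻ nz? y∈
               in supp x∈′ y∈′ fx≢0 fy≢0)))
    where
      nz? : ∀ x → Dec (f x ≢ 0)
      nz? x = ¬? (f x ℕ.≟ 0)
      length≤1 : {ys : List A} → Unique ys → (∀ {x y} → x ∈ ys → y ∈ ys → x ≡ y) → length ys ≤ 1
      length≤1 {[]}         u         same = z≤n
      length≤1 {x ∷ []}     u         same = s≤s z≤n
      length≤1 {x ∷ y ∷ ys} ((x≢y ∷ _) ∷ _) same = ⊥-elim (x≢y (same (here refl) (there (here refl))))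

𝟙 : {P : Set} → Dec P → ℕ
𝟙 (yes _) = 1
𝟙 (no  _) = 0

module _ {P : Set} where

  𝟙-yes : (d : Dec P) → P → 𝟙 d ≡ 1
  𝟙-yes (yes _) _  = refl
  𝟙-yes (no ¬p) p = ⊥-elim (¬p p)

  𝟙-no : (d : Dec P) → ¬ P → 𝟙 d ≡ 0
  𝟙-no (yes p) ¬p = ⊥-elim (¬p p)
  𝟙-no (no  _) _  = refl

  𝟙-≤-1 : (d : Dec P) → 𝟙 d ≤ 1
  𝟙-≤-1 (yes _) = s≤s z≤n
  𝟙-≤-1 (no  _) = z≤n

  𝟙≢0⇒ : (d : Dec P) → 𝟙 d ≢ 0 → P
  𝟙≢0⇒ (yes p) _   = p
  𝟙≢0⇒ (no  _) 𝟙≢0 = ⊥-elim (𝟙≢0 refl)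

𝟙-cong : {P Q : Set} (d : Dec P) (e : Dec Q) → (P → Q) → (Q → P) → 𝟙 d ≡ 𝟙 e
𝟙-cong (yes p) e       P→Q Q→P = sym (𝟙-yes e (P→Q p))
𝟙-cong (no ¬p) e       P→Q Q→P = sym (𝟙-no e (¬p ∘ Q→P))

inside : ℕ → ℕ → ℕ → ℕ
inside a b c = 𝟙 ((a <? c) ×-dec (c <? b))

between : ℕ → ℕ → ℕ → ℕ
between a b c = inside a b c + inside b a c

between-comm : ∀ a b c → between a b c ≡ between b a c
between-comm a b c = +-comm (inside a b c) (inside b a c)

between≢0⇒ : ∀ {a b c} → between a b c ≢ 0 → (a < c × c < b) ⊎ (b < c × c < a)
between≢0⇒ {a} {b} {c} ne with inside a b c ℕ.≟ 0
... | no  ne′ = inj₁ (𝟙≢0⇒ ((a <? c) ×-dec (c <? b)) ne′)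
... | yes eq  = inj₂ (𝟙≢0⇒ ((b <? c) ×-dec (c <? a)) (λ eq′ → ne (cong₂ _+_ eq eq′)))

∑< : ℕ → (ℕ → ℕ) → ℕ
∑< zero    g = 0
∑< (suc n) g = g 0 + ∑< n (g ∘ suc)

∑<-suc : ∀ g n → ∑< (suc n) g ≡ ∑< n g + g n
∑<-suc g zero    = +-comm (g 0) 0
∑<-suc g (suc n) = trans (cong (g 0 +_) (∑<-suc (g ∘ suc) n)) (sym (+-assoc (g 0) _ _))

∑-tabulate : ∀ {A : Set} n (h : Fin n → A) (f : A → ℕ) (g : ℕ → ℕ) →
             (∀ i → f (h i) ≡ g (toℕ i)) → ∑ (tabulate h) f ≡ ∑< n g
∑-tabulate zero    h f g eq = refl
∑-tabulate (suc n) h f g eq = cong₂ _+_ (eq zero) (∑-tabulate n (h ∘ suc) f (g ∘ suc) (eq ∘ suc))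

∑-allFin : ∀ n (g : ℕ → ℕ) → ∑ (allFin n) (g ∘ toℕ) ≡ ∑< n g
∑-allFin n g = ∑-tabulate n (λ i → i) (g ∘ toℕ) g (λ _ → refl)

∑<-inside-≤ : ∀ a b n → n ≤ b → ∑< n (inside a b) ≡ n ∸ suc a
∑<-inside-≤ a b zero    _    = refl
∑<-inside-≤ a b (suc n) n<b with n ≤? a
... | no n≰a = begin
  ∑< (suc n) (inside a b)  ≡⟨ ∑<-suc (inside a b) n ⟩
  ∑< n (inside a b) + inside a b n
    ≡⟨ cong₂ _+_ (∑<-inside-≤ a b n (<⇒≤ n<b)) (𝟙-yes ((a <? n) ×-dec (n <? b)) (a<n , n<b)) ⟩
  n ∸ suc a + 1            ≡⟨ +-comm (n ∸ suc a) 1 ⟩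
  suc (n ∸ suc a)          ≡⟨ sym (+-∸-assoc 1 a<n) ⟩
  suc n ∸ suc a            ∎
  where
    open ≡-Reasoning
    a<n = ≰⇒> n≰a
... | yes n≤a = begin
  ∑< (suc n) (inside a b)  ≡⟨ ∑<-suc (inside a b) n ⟩
  ∑< n (inside a b) + inside a b n
    ≡⟨ cong₂ _+_ (∑<-inside-≤ a b n (<⇒≤ n<b)) (𝟙-no ((a <? n) ×-dec (n <? b)) (≤⇒≯ n≤a ∘ proj₁)) ⟩
  n ∸ suc a + 0            ≡⟨ cong (_+ 0) (m≤n⇒m∸n≡0 (m≤n⇒m≤1+n n≤a)) ⟩
  0                        ≡⟨ sym (m≤n⇒m∸n≡0 n≤a) ⟩
  suc n ∸ suc a            ∎
  where open ≡-Reasoning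

∑<-inside : ∀ a b n → b ≤ n → ∑< n (inside a b) ≡ b ∸ suc a
∑<-inside a b n b≤n with m≤n⇒m<n∨m≡n b≤n
... | inj₂ refl = ∑<-inside-≤ a b n ≤-refl
∑<-inside a b (suc n) b≤n | inj₁ (s≤s b≤n′) = begin
  ∑< (suc n) (inside a b)  ≡⟨ ∑<-suc (inside a b) n ⟩
  ∑< n (inside a b) + inside a b n
    ≡⟨ cong₂ _+_ (∑<-inside a b n b≤n′) (𝟙-no ((a <? n) ×-dec (n <? b)) (≤⇒≯ b≤n′ ∘ proj₂)) ⟩
  b ∸ suc a + 0            ≡⟨ +-identityʳ _ ⟩
  b ∸ suc a                ∎
  where open ≡-Reasoning

∑-between : ∀ n a b → a < b → b ≤ n → ∑ (allFin n) (between a b ∘ toℕ) ≡ b ∸ suc a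
∑-between n a b a<b b≤n = begin
  ∑ (allFin n) (between a b ∘ toℕ)
    ≡⟨ ∑-distrib-+ (allFin n) (inside a b ∘ toℕ) (inside b a ∘ toℕ) ⟩
  ∑ (allFin n) (inside a b ∘ toℕ) + ∑ (allFin n) (inside b a ∘ toℕ)
    ≡⟨ cong₂ _+_ (∑-allFin n (inside a b)) (∑-allFin n (inside b a)) ⟩
  ∑< n (inside a b) + ∑< n (inside b a)
    ≡⟨ cong₂ _+_ (∑<-inside a b n b≤n) (∑<-zero n (λ c → 𝟙-no _ (λ (b<c , c<a) → <-asym a<b (<-trans b<c c<a)))) ⟩
  b ∸ suc a + 0            ≡⟨ +-identityʳ _ ⟩
  b ∸ suc a                ∎
  where
    open ≡-Reasoning
    ∑<-zero : ∀ n {g} → (∀ c → g c ≡ 0) → ∑< n g ≡ 0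
    ∑<-zero zero    eq = refl
    ∑<-zero (suc n) eq = cong₂ _+_ (eq 0) (∑<-zero n (eq ∘ suc))

∣-∣≡1+∑-between : ∀ n {a b} → a ≢ b → a < n → b < n → ∣ a - b ∣ ≡ suc (∑ (allFin n) (between a b ∘ toℕ))
∣-∣≡1+∑-between n {a} {b} a≢b a<n b<n with <-cmp a b
... | tri≈ _ a≡b _ = ⊥-elim (a≢b a≡b)
... | tri< a<b _ _ = begin
  ∣ a - b ∣                 ≡⟨ m≤n⇒∣m-n∣≡n∸m (<⇒≤ a<b) ⟩
  b ∸ a                     ≡⟨ +-∸-assoc 1 a<b ⟩
  suc (b ∸ suc a)           ≡⟨ cong suc (sym (∑-between n a b a<b (<⇒≤ b<n))) ⟩
  suc (∑ (allFin n) (between a b ∘ toℕ)) ∎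
  where open ≡-Reasoning
... | tri> _ _ b<a = begin
  ∣ a - b ∣                 ≡⟨ m≤n⇒∣n-m∣≡n∸m (<⇒≤ b<a) ⟩
  a ∸ b                     ≡⟨ +-∸-assoc 1 b<a ⟩
  suc (a ∸ suc b)           ≡⟨ cong suc (sym (∑-between n b a b<a (<⇒≤ a<n))) ⟩
  suc (∑ (allFin n) (between b a ∘ toℕ)) ≡⟨ cong suc (∑-cong (allFin n) (λ {i} _ → between-comm b a (toℕ i))) ⟩
  suc (∑ (allFin n) (between a b ∘ toℕ)) ∎
  where open ≡-Reasoning

-- Arithmetic of ⌊(k - 1)² / 4⌋

choose₂ : ℕ → ℕ
choose₂ zero    = 0
choose₂ (suc a) = a + choose₂ a

quarterSquare : ℕ → ℕ
quarterSquare 0               = 0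
quarterSquare 1               = 0
quarterSquare (suc (suc k)) = quarterSquare k + k

DifferByOne : ℕ → ℕ → Set
DifferByOne a b = b ≡ suc a ⊎ a ≡ suc b

Balanced : ℕ → ℕ → Set
Balanced a b = a ≡ b ⊎ DifferByOne a b

private
  +-+-interchange : ∀ a b x y → x + y + (a + b) ≡ (a + x) + (b + y)
  +-+-interchange = solve-∀

quarterSquare≤choose₂ : ∀ b → quarterSquare b ≤ choose₂ b
quarterSquare≤choose₂ 0               = z≤n
quarterSquare≤choose₂ 1               = z≤n
quarterSquare≤choose₂ (suc (suc b)) = begin
  quarterSquare b + b  ≤⟨ +-monoˡ-≤ b (quarterSquare≤choose₂ b) ⟩
  choose₂ b + b        ≤⟨ m≤n+m (choose₂ b + b) (suc b) ⟩
  suc b + (choose₂ b + b) ≡⟨ cong (suc b +_) (+-comm (choose₂ b) b) ⟩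
  choose₂ (suc (suc b)) ∎
  where open ≤-Reasoning

quarterSquare-+-≤ : ∀ a b → quarterSquare (a + b) ≤ choose₂ a + choose₂ b
quarterSquare-+-≤ zero    b       = quarterSquare≤choose₂ b
quarterSquare-+-≤ (suc a) zero    = begin
  quarterSquare (suc a + 0) ≡⟨ cong quarterSquare (+-identityʳ (suc a)) ⟩
  quarterSquare (suc a)     ≤⟨ quarterSquare≤choose₂ (suc a) ⟩
  choose₂ (suc a)           ≤⟨ m≤m+n _ 0 ⟩
  choose₂ (suc a) + 0       ∎
  where open ≤-Reasoning
quarterSquare-+-≤ (suc a) (suc b) rewrite +-suc a b = begin
  quarterSquare (a + b) + (a + b)  ≤⟨ +-monoˡ-≤ (a + b) (quarterSquare-+-≤ a b) ⟩
  choose₂ a + choose₂ b + (a + b)  ≡⟨ +-+-interchange a b (choose₂ a) (choose₂ b) ⟩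
  choose₂ (suc a) + choose₂ (suc b) ∎
  where open ≤-Reasoning

quarterSquare-balanced : ∀ a b → Balanced a b → quarterSquare (a + b) ≡ choose₂ a + choose₂ b
quarterSquare-balanced a .a       (inj₁ refl)        = double a
  where
    double : ∀ a → quarterSquare (a + a) ≡ choose₂ a + choose₂ a
    double zero    = refl
    double (suc a) rewrite +-suc a a =
      trans (cong (_+ (a + a)) (double a)) (+-+-interchange a a (choose₂ a) (choose₂ a))
quarterSquare-balanced a .(suc a) (inj₂ (inj₁ refl)) = almostDouble a
  where
    almostDouble : ∀ a → quarterSquare (a + suc a) ≡ choose₂ a + choose₂ (suc a)
    almostDouble zero    = refl
    almostDouble (suc a) rewrite +-suc a (suc a) =
      trans (cong (_+ (a + suc a)) (almostDouble a)) (+-+-interchange a (suc a) (choose₂ a) (choose₂ (suc a)))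
quarterSquare-balanced .(suc b) b (inj₂ (inj₂ refl)) = begin
  quarterSquare (suc b + b)         ≡⟨ cong quarterSquare (+-comm (suc b) b) ⟩
  quarterSquare (b + suc b)         ≡⟨ quarterSquare-balanced b (suc b) (inj₂ (inj₁ refl)) ⟩
  choose₂ b + choose₂ (suc b)       ≡⟨ +-comm (choose₂ b) (choose₂ (suc b)) ⟩
  choose₂ (suc b) + choose₂ b       ∎
  where open ≡-Reasoning

⌊[k∸1]²/4⌋≡quarterSquare : ∀ k → ((k ∸ 1) ^ 2) / 4 ≡ quarterSquare k
⌊[k∸1]²/4⌋≡quarterSquare 0 = refl
⌊[k∸1]²/4⌋≡quarterSquare 1 = refl
⌊[k∸1]²/4⌋≡quarterSquare 2 = refl
⌊[k∸1]²/4⌋≡quarterSquare (suc (suc (suc j))) = begin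
  ((2 + j) ^ 2) / 4                 ≡⟨ cong (_/ 4) (square-step j) ⟩
  (j ^ 2 + (1 + j) * 4) / 4         ≡⟨ +-distrib-/-∣ʳ (j ^ 2) (n∣m*n (suc j)) ⟩
  (j ^ 2) / 4 + ((1 + j) * 4) / 4   ≡⟨ cong₂ _+_ (⌊[k∸1]²/4⌋≡quarterSquare (suc j)) (m*n/n≡m (suc j) 4) ⟩
  quarterSquare (suc j) + suc j     ∎
  where
    open ≡-Reasoning
    square-step : ∀ j → (2 + j) * ((2 + j) * 1) ≡ j * (j * 1) + (1 + j) * 4
    square-step = solve-∀

⌊[k+1]²/4⌋≡quarterSquare+k : ∀ k → ((k + 1) ^ 2) / 4 ≡ quarterSquare k + k
⌊[k+1]²/4⌋≡quarterSquare+k k = trans (cong (λ z → (z ^ 2) / 4) (+-comm k 1)) (⌊[k∸1]²/4⌋≡quarterSquare (2 + k))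

4*quarterSquare+2k≡k²+parity : ∀ k → 4 * quarterSquare k + 2 * k ≡ k ^ 2 + k % 2
4*quarterSquare+2k≡k²+parity 0 = refl
4*quarterSquare+2k≡k²+parity 1 = refl
4*quarterSquare+2k≡k²+parity (suc (suc k)) = begin
  4 * (quarterSquare k + k) + 2 * (2 + k)      ≡⟨ regroupˡ (quarterSquare k) k ⟩
  (4 * quarterSquare k + 2 * k) + (4 * k + 4)  ≡⟨ cong (_+ (4 * k + 4)) (4*quarterSquare+2k≡k²+parity k) ⟩
  (k ^ 2 + k % 2) + (4 * k + 4)                ≡⟨ regroupʳ k (k % 2) ⟩
  (2 + k) ^ 2 + k % 2                          ∎
  where
    open ≡-Reasoning
    regroupˡ : ∀ h k → 4 * (h + k) + 2 * (2 + k) ≡ (4 * h + 2 * k) + (4 * k + 4)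
    regroupˡ = solve-∀
    regroupʳ : ∀ k r → (k * (k * 1) + r) + (4 * k + 4) ≡ (2 + k) * ((2 + k) * 1) + r
    regroupʳ = solve-∀

-- Pairs of points nested on one side of a centre

inside-yes : ∀ {a b c} → a < c → c < b → inside a b c ≡ 1
inside-yes {a} {b} {c} a<c c<b = 𝟙-yes ((a <? c) ×-dec (c <? b)) (a<c , c<b)

inside-noˡ : ∀ {a b c} → ¬ a < c → inside a b c ≡ 0
inside-noˡ {a} {b} {c} a≮c = 𝟙-no ((a <? c) ×-dec (c <? b)) (a≮c ∘ proj₁)

inside-noʳ : ∀ {a b c} → ¬ c < b → inside a b c ≡ 0
inside-noʳ {a} {b} {c} c≮b = 𝟙-no ((a <? c) ×-dec (c <? b)) (c≮b ∘ proj₂)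

separated : ℕ → ℕ → ℕ → ℕ
separated c x y = between c x y + between c y x

separated-below : ∀ {c y z} → y ≢ z → y ≢ c → z < c → separated c z y ≡ 𝟙 (y <? c)
separated-below {c} {y} {z} y≢z y≢c z<c with <-cmp y c | <-cmp y z
... | tri≈ _ y≡c _ | _            = ⊥-elim (y≢c y≡c)
... | _            | tri≈ _ y≡z _ = ⊥-elim (y≢z y≡z)
... | tri< y<c _ _ | tri< y<z _ _ = sym (trans (𝟙-yes (y <? c) y<c) (sym (cong₂ _+_
  (cong₂ _+_ (inside-noˡ (<⇒≯ y<c)) (inside-noˡ (<⇒≯ y<z)))
  (cong₂ _+_ (inside-noˡ (<⇒≯ z<c)) (inside-yes y<z z<c)))))
... | tri< y<c _ _ | tri> _ _ z<y = sym (trans (𝟙-yes (y <? c) y<c) (sym (cong₂ _+_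
  (cong₂ _+_ (inside-noˡ (<⇒≯ y<c)) (inside-yes z<y y<c))
  (cong₂ _+_ (inside-noˡ (<⇒≯ z<c)) (inside-noˡ (<⇒≯ z<y))))))
... | tri> _ _ c<y | _            = sym (trans (𝟙-no (y <? c) (<⇒≯ c<y)) (sym (cong₂ _+_
  (cong₂ _+_ (inside-noʳ (<⇒≯ (<-trans z<c c<y))) (inside-noʳ (<⇒≯ c<y)))
  (cong₂ _+_ (inside-noˡ (<⇒≯ z<c)) (inside-noˡ (<⇒≯ (<-trans z<c c<y)))))))

separated-above : ∀ {c y z} → y ≢ z → y ≢ c → c < z → separated c z y ≡ 𝟙 (c <? y)
separated-above {c} {y} {z} y≢z y≢c c<z with <-cmp y c | <-cmp y z
... | tri≈ _ y≡c _ | _            = ⊥-elim (y≢c y≡c)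
... | _            | tri≈ _ y≡z _ = ⊥-elim (y≢z y≡z)
... | tri> _ _ c<y | tri< y<z _ _ = sym (trans (𝟙-yes (c <? y) c<y) (sym (cong₂ _+_
  (cong₂ _+_ (inside-yes c<y y<z) (inside-noˡ (<⇒≯ y<z)))
  (cong₂ _+_ (inside-noʳ (<⇒≯ y<z)) (inside-noʳ (<⇒≯ c<z))))))
... | tri> _ _ c<y | tri> _ _ z<y = sym (trans (𝟙-yes (c <? y) c<y) (sym (cong₂ _+_
  (cong₂ _+_ (inside-noʳ (<⇒≯ z<y)) (inside-noʳ (<⇒≯ c<y)))
  (cong₂ _+_ (inside-yes c<z z<y) (inside-noˡ (<⇒≯ z<y))))))
... | tri< y<c _ _ | _            = sym (trans (𝟙-no (c <? y) (<⇒≯ y<c)) (sym (cong₂ _+_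
  (cong₂ _+_ (inside-noˡ (<⇒≯ y<c)) (inside-noˡ (<⇒≯ (<-trans y<c c<z))))
  (cong₂ _+_ (inside-noʳ (<⇒≯ (<-trans y<c c<z))) (inside-noʳ (<⇒≯ c<z))))))

left right : ℕ → List ℕ → ℕ
left  c L = ∑ L (λ y → 𝟙 (y <? c))
right c L = ∑ L (λ y → 𝟙 (c <? y))

left+right≡length : ∀ c L → c ∉ L → left c L + right c L ≡ length L
left+right≡length c L c∉L = begin
  left c L + right c L                       ≡⟨ ∑-distrib-+ L (λ y → 𝟙 (y <? c)) (λ y → 𝟙 (c <? y)) ⟨
  ∑ L (λ y → 𝟙 (y <? c) + 𝟙 (c <? y))       ≡⟨ ∑-cong L one-side ⟩
  ∑ L (λ _ → 1)                              ≡⟨ ∑-one L ⟩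
  length L                                   ∎
  where
    open ≡-Reasoning
    one-side : ∀ {y} → y ∈ L → 𝟙 (y <? c) + 𝟙 (c <? y) ≡ 1
    one-side {y} y∈L with <-cmp y c
    ... | tri≈ _ y≡c _ = ⊥-elim (c∉L (subst (_∈ L) y≡c y∈L))
    ... | tri< y<c _ _ = cong₂ _+_ (𝟙-yes (y <? c) y<c) (𝟙-no (c <? y) (<⇒≯ y<c))
    ... | tri> _ _ c<y = cong₂ _+_ (𝟙-no (y <? c) (<⇒≯ c<y)) (𝟙-yes (c <? y) c<y)

enclosed : ℕ → List ℕ → ℕ
enclosed c L = ∑ L (λ x → ∑ L (between c x))

enclosed-∷ : ∀ c z L → enclosed c (z ∷ L) ≡ ∑ L (separated c z) + enclosed c L
enclosed-∷ c z L = begin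
  (between c z z + ∑ L (between c z)) + ∑ L (λ x → between c x z + ∑ L (between c x))
    ≡⟨ cong₂ _+_ (cong (_+ ∑ L (between c z)) between-self) (∑-distrib-+ L (λ x → between c x z) (λ x → ∑ L (between c x))) ⟩
  ∑ L (between c z) + (∑ L (λ x → between c x z) + enclosed c L)
    ≡⟨ +-assoc (∑ L (between c z)) _ _ ⟨
  (∑ L (between c z) + ∑ L (λ x → between c x z)) + enclosed c L
    ≡⟨ cong (_+ enclosed c L) (∑-distrib-+ L (between c z) (λ x → between c x z)) ⟨
  ∑ L (separated c z) + enclosed c L ∎
  where
    open ≡-Reasoning
    between-self : between c z z ≡ 0
    between-self = cong₂ _+_ (inside-noʳ {c} (<-irrefl refl)) (inside-noˡ {z} {c} (<-irrefl refl))

module _ {c z : ℕ} {L : List ℕ} (z∉L : All (z ≢_) L) (c∉L : c ∉ L) where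

  private
    separated≡ : ∀ {f : ℕ → ℕ} → (∀ {y} → y ≢ z → y ≢ c → separated c z y ≡ f y) → ∑ L (separated c z) ≡ ∑ L f
    separated≡ sep = ∑-cong L (λ y∈ → sep (λ y≡z → All.lookup z∉L y∈ (sym y≡z)) (λ y≡c → c∉L (subst (_∈ L) y≡c y∈)))

  enclosed-∷-below : z < c → enclosed c (z ∷ L) ≡ left c L + enclosed c L
  enclosed-∷-below z<c = trans (enclosed-∷ c z L) (cong (_+ enclosed c L) (separated≡ (λ y≢z y≢c → separated-below y≢z y≢c z<c)))

  enclosed-∷-above : c < z → enclosed c (z ∷ L) ≡ right c L + enclosed c L
  enclosed-∷-above c<z = trans (enclosed-∷ c z L) (cong (_+ enclosed c L) (separated≡ (λ y≢z y≢c → separated-above y≢z y≢c c<z)))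

enclosed≡choose₂ : ∀ c L → Unique L → c ∉ L → enclosed c L ≡ choose₂ (left c L) + choose₂ (right c L)
enclosed≡choose₂ c []      u          c∉ = refl
enclosed≡choose₂ c (z ∷ L) (z∉L ∷ u) c∉ with <-cmp z c
... | tri≈ _ z≡c _ = ⊥-elim (c∉ (here (sym z≡c)))
... | tri< z<c _ _ = begin
  enclosed c (z ∷ L)                   ≡⟨ enclosed-∷-below z∉L (c∉ ∘ there) z<c ⟩
  l + enclosed c L                     ≡⟨ cong (l +_) (enclosed≡choose₂ c L u (c∉ ∘ there)) ⟩
  l + (choose₂ l + choose₂ r)          ≡⟨ +-assoc l (choose₂ l) (choose₂ r) ⟨
  choose₂ (suc l) + choose₂ r
    ≡⟨ cong₂ (λ a b → choose₂ (a + l) + choose₂ (b + r)) (𝟙-yes (z <? c) z<c) (𝟙-no (c <? z) (<⇒≯ z<c)) ⟨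
  choose₂ (left c (z ∷ L)) + choose₂ (right c (z ∷ L)) ∎
  where
    open ≡-Reasoning
    l = left c L
    r = right c L
... | tri> _ _ c<z = begin
  enclosed c (z ∷ L)                   ≡⟨ enclosed-∷-above z∉L (c∉ ∘ there) c<z ⟩
  r + enclosed c L                     ≡⟨ cong (r +_) (enclosed≡choose₂ c L u (c∉ ∘ there)) ⟩
  r + (choose₂ l + choose₂ r)          ≡⟨ +-left-comm r (choose₂ l) (choose₂ r) ⟩
  choose₂ l + choose₂ (suc r)
    ≡⟨ cong₂ (λ a b → choose₂ (a + l) + choose₂ (b + r)) (𝟙-no (z <? c) (<⇒≯ c<z)) (𝟙-yes (c <? z) c<z) ⟨
  choose₂ (left c (z ∷ L)) + choose₂ (right c (z ∷ L)) ∎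
  where
    open ≡-Reasoning
    l = left c L
    r = right c L
    +-left-comm : ∀ a b c → a + (b + c) ≡ b + (a + c)
    +-left-comm = solve-∀

quarterSquare≤enclosed : ∀ c L → Unique L → c ∉ L → quarterSquare (length L) ≤ enclosed c L
quarterSquare≤enclosed c L u c∉ = begin
  quarterSquare (length L)                      ≡⟨ cong quarterSquare (left+right≡length c L c∉) ⟨
  quarterSquare (left c L + right c L)          ≤⟨ quarterSquare-+-≤ (left c L) (right c L) ⟩
  choose₂ (left c L) + choose₂ (right c L)      ≡⟨ enclosed≡choose₂ c L u c∉ ⟨
  enclosed c L                                  ∎
  where open ≤-Reasoning

enclosed≡quarterSquare : ∀ c L → Unique L → c ∉ L → Balanced (left c L) (right c L) →
                         enclosed c L ≡ quarterSquare (length L)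
enclosed≡quarterSquare c L u c∉ bal = begin
  enclosed c L                                  ≡⟨ enclosed≡choose₂ c L u c∉ ⟩
  choose₂ (left c L) + choose₂ (right c L)      ≡⟨ quarterSquare-balanced (left c L) (right c L) bal ⟨
  quarterSquare (left c L + right c L)          ≡⟨ cong quarterSquare (left+right≡length c L c∉) ⟩
  quarterSquare (length L)                      ∎
  where open ≡-Reasoning

⟨$⟩ʳ-injective : ∀ {n} (π : Permutation′ n) {x y} → π ⟨$⟩ʳ x ≡ π ⟨$⟩ʳ y → x ≡ y
⟨$⟩ʳ-injective π eq = trans (sym (inverseˡ π)) (trans (cong (π ⟨$⟩ˡ_) eq) (inverseˡ π))

∑-permute-≤ : ∀ {n} (π : Permutation′ n) (g : Fin n → ℕ) → ∑ (allFin n) (g ∘ (π ⟨$⟩ʳ_)) ≤ ∑ (allFin n) g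
∑-permute-≤ {n} π g = begin
  ∑ (allFin n) (g ∘ (π ⟨$⟩ʳ_))     ≡⟨ ∑-map (allFin n) (π ⟨$⟩ʳ_) g ⟨
  ∑ (map (π ⟨$⟩ʳ_) (allFin n)) g   ≤⟨ ∑-⊆ _≟_ (allFin n) g (Unique.map⁺ (⟨$⟩ʳ-injective π) (Unique.allFin⁺ n))
                                                          (λ {x} _ → ∈-allFin x) ⟩
  ∑ (allFin n) g                   ∎
  where open ≤-Reasoning

∑-permute : ∀ {n} (π : Permutation′ n) (g : Fin n → ℕ) → ∑ (allFin n) (g ∘ (π ⟨$⟩ʳ_)) ≡ ∑ (allFin n) g
∑-permute {n} π g = ≤-antisym (∑-permute-≤ π g) (begin
  ∑ (allFin n) g                               ≡⟨ ∑-cong (allFin n) (λ _ → cong g (sym (inverseʳ π))) ⟩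
  ∑ (allFin n) (g ∘ (π ⟨$⟩ʳ_) ∘ (π ⟨$⟩ˡ_))    ≤⟨ ∑-permute-≤ (flip π) (g ∘ (π ⟨$⟩ʳ_)) ⟩
  ∑ (allFin n) (g ∘ (π ⟨$⟩ʳ_))                 ∎)
  where open ≤-Reasoning

module Positions {n : ℕ} (π : Permutation′ n) where

  pos : Fin n → ℕ
  pos w = toℕ (π ⟨$⟩ʳ w)

  pos-injective : ∀ {x y} → pos x ≡ pos y → x ≡ y
  pos-injective = ⟨$⟩ʳ-injective π ∘ toℕ-injective

  ∣pos-pos∣≡1+∑-between : ∀ {u v} → u ≢ v →
    ∣ pos u - pos v ∣ ≡ suc (∑ (allFin n) (λ w → between (pos u) (pos v) (pos w)))
  ∣pos-pos∣≡1+∑-between u≢v =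
    trans (∣-∣≡1+∑-between n (u≢v ∘ pos-injective) (toℕ<n _) (toℕ<n _))
          (cong suc (sym (∑-permute π (between _ _ ∘ toℕ))))

-- Neighbourhoods and double counting

Incident : ∀ {n} → Fin n → Edge n → Set
Incident v e = (proj₁ e ≡ v) ⊎ (proj₂ e ≡ v)

incident? : ∀ {n} (v : Fin n) (e : Edge n) → Dec (Incident v e)
incident? v e = (proj₁ e ≟ v) ⊎-dec (proj₂ e ≟ v)

other : ∀ {n} → Fin n → Edge n → Fin n
other v (a , b) with a ≟ v
... | yes _ = b
... | no  _ = a

module _ {n : ℕ} where

  other-incident : ∀ (v : Fin n) e → Incident v e → e ≡ (v , other v e) ⊎ e ≡ (other v e , v)
  other-incident v (a , b) i with a ≟ v
  ... | yes refl = inj₁ refl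
  other-incident v (a , b)  (inj₁ a≡v)  | no a≢v = ⊥-elim (a≢v a≡v)
  other-incident v (a , .v) (inj₂ refl) | no _   = inj₂ refl

  otherˡ : ∀ (u w : Fin n) → other u (u , w) ≡ w
  otherˡ u w with u ≟ u
  ... | yes _   = refl
  ... | no  u≢u = ⊥-elim (u≢u refl)

  otherʳ : ∀ (u w : Fin n) → other u (w , u) ≡ w
  otherʳ u w with w ≟ u
  ... | yes w≡u = sym w≡u
  ... | no  _   = refl

  other-SameEdge : ∀ (v : Fin n) e f → Incident v e → Incident v f → other v e ≡ other v f → SameEdge e f
  other-SameEdge v e f ie if eq with other-incident v e ie | other-incident v f if
  ... | inj₁ p | inj₁ q = inj₁ (trans (cong proj₁ p) (sym (cong proj₁ q)) , trans (cong proj₂ p) (trans eq (sym (cong proj₂ q))))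
  ... | inj₁ p | inj₂ q = inj₂ (trans (cong proj₁ p) (sym (cong proj₂ q)) , trans (cong proj₂ p) (trans eq (sym (cong proj₁ q))))
  ... | inj₂ p | inj₁ q = inj₂ (trans (cong proj₁ p) (trans eq (sym (cong proj₂ q))) , trans (cong proj₂ p) (sym (cong proj₁ q)))
  ... | inj₂ p | inj₂ q = inj₁ (trans (cong proj₁ p) (trans eq (sym (cong proj₁ q))) , trans (cong proj₂ p) (sym (cong proj₂ q)))

  double-count : (F : List (Edge n)) → (∀ {e} → e ∈ F → proj₁ e ≢ proj₂ e) → (g : Fin n → Fin n → ℕ) →
    ∑ (allFin n) (λ v → ∑ (filter (incident? v) F) (g v ∘ other v))
    ≡ ∑ F (λ e → g (proj₁ e) (proj₂ e) + g (proj₂ e) (proj₁ e))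
  double-count []             loopless g = ∑-zero (allFin n) (λ _ → refl)
  double-count ((a , b) ∷ F) loopless g = begin
    ∑ (allFin n) (λ v → ∑ (filter (incident? v) ((a , b) ∷ F)) (g v ∘ other v))
      ≡⟨ ∑-cong (allFin n) (λ {v} _ → trans (cong (λ l → ∑ l (g v ∘ other v)) (filter-++ (incident? v) ((a , b) ∷ []) F))
                                             (∑-++ (filter (incident? v) ((a , b) ∷ [])) _ (g v ∘ other v))) ⟩
    ∑ (allFin n) (λ v → atEdge v + ∑ (filter (incident? v) F) (g v ∘ other v))
      ≡⟨ ∑-distrib-+ (allFin n) atEdge (λ v → ∑ (filter (incident? v) F) (g v ∘ other v)) ⟩
    ∑ (allFin n) atEdge + ∑ (allFin n) (λ v → ∑ (filter (incident? v) F) (g v ∘ other v))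
      ≡⟨ cong₂ _+_ (∑-pair atEdge (Unique.allFin⁺ n) (∈-allFin a) (∈-allFin b) (loopless (here refl)) atEdge-off)
                   (double-count F (loopless ∘ there) g) ⟩
    (atEdge a + atEdge b) + ∑ F (λ e → g (proj₁ e) (proj₂ e) + g (proj₂ e) (proj₁ e))
      ≡⟨ cong₂ (λ x y → (x + y) + ∑ F (λ e → g (proj₁ e) (proj₂ e) + g (proj₂ e) (proj₁ e))) atEdge-a atEdge-b ⟩
    (g a b + g b a) + ∑ F (λ e → g (proj₁ e) (proj₂ e) + g (proj₂ e) (proj₁ e)) ∎
    where
      open ≡-Reasoning
      atEdge : Fin n → ℕ
      atEdge v = ∑ (filter (incident? v) ((a , b) ∷ [])) (g v ∘ other v)
      atEdge-off : ∀ {v} → v ∈ allFin n → v ≢ a → v ≢ b → atEdge v ≡ 0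
      atEdge-off {v} _ v≢a v≢b = cong (λ l → ∑ l (g v ∘ other v))
        (filter-reject (incident? v) {a , b} {[]} λ { (inj₁ a≡v) → v≢a (sym a≡v) ; (inj₂ b≡v) → v≢b (sym b≡v) })
      atEdge-a : atEdge a ≡ g a b
      atEdge-a = trans (cong (λ l → ∑ l (g a ∘ other a)) (filter-accept (incident? a) {a , b} {[]} (inj₁ refl)))
                       (trans (+-identityʳ _) (cong (g a) (otherˡ a b)))
      atEdge-b : atEdge b ≡ g b a
      atEdge-b = trans (cong (λ l → ∑ l (g b ∘ other b)) (filter-accept (incident? b) {a , b} {[]} (inj₂ refl)))
                       (trans (+-identityʳ _) (cong (g b) (otherʳ b a)))

module SimpleGraph {n : ℕ} (E : List (Edge n)) (simple : Simple E) where

  neighbours : Fin n → List (Fin n)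
  neighbours v = map (other v) (filter (incident? v) E)

  loopless : ∀ {e} → e ∈ E → proj₁ e ≢ proj₂ e
  loopless {a , b} = proj₁ simple

  Adj⇒∈neighbours : ∀ {u w} → Adj E u w → w ∈ neighbours u
  Adj⇒∈neighbours {u} {w} (inj₁ e∈) =
    subst (_∈ neighbours u) (otherˡ u w) (∈-map⁺ (other u) (∈-filter⁺ (incident? u) e∈ (inj₁ refl)))
  Adj⇒∈neighbours {u} {w} (inj₂ e∈) =
    subst (_∈ neighbours u) (otherʳ u w) (∈-map⁺ (other u) (∈-filter⁺ (incident? u) e∈ (inj₂ refl)))

  ∈neighbours⇒Adj : ∀ {u w} → w ∈ neighbours u → Adj E u w
  ∈neighbours⇒Adj {u} w∈ with e , e∈ , refl ← ∈-map⁻ (other u) w∈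
                           with e∈E , i ← ∈-filter⁻ (incident? u) e∈
                           with other-incident u e i
  ... | inj₁ eq = inj₁ (subst (_∈ E) eq e∈E)
  ... | inj₂ eq = inj₂ (subst (_∈ E) eq e∈E)

  Adj-sym : ∀ {u w} → Adj E u w → Adj E w u
  Adj-sym (inj₁ e∈) = inj₂ e∈
  Adj-sym (inj₂ e∈) = inj₁ e∈

  neighbours-sym : ∀ {u w} → w ∈ neighbours u → u ∈ neighbours w
  neighbours-sym = Adj⇒∈neighbours ∘ Adj-sym ∘ ∈neighbours⇒Adj

  neighbours-≢ : ∀ {u w} → w ∈ neighbours u → u ≢ w
  neighbours-≢ w∈ with ∈neighbours⇒Adj w∈
  ... | inj₁ e∈ = proj₁ simple e∈
  ... | inj₂ e∈ = proj₁ simple e∈ ∘ sym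

  TriangleFree : Set
  TriangleFree = ∀ {u v w} → v ∈ neighbours u → w ∈ neighbours u → ¬ w ∈ neighbours v

  neighbours-unique : ∀ v → Unique (neighbours v)
  neighbours-unique v =
    map-other-unique (filter (incident? v) E) (all-filter (incident? v) E) (AllPairs.filter⁺ (incident? v) (proj₂ simple))
    where
      map-other-unique : ∀ es → All (Incident v) es → AllPairs (λ e f → ¬ SameEdge e f) es → Unique (map (other v) es)
      map-other-unique []       _          _            = []
      map-other-unique (e ∷ es) (ie ∷ ies) (e≁ ∷ distinct) = distinct-from-e ies e≁ ∷ map-other-unique es ies distinct
        where
          distinct-from-e : ∀ {fs} → All (Incident v) fs → All (λ f → ¬ SameEdge e f) fs →
                            All (λ w → other v e ≢ w) (map (other v) fs)
          distinct-from-e []         []         = []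
          distinct-from-e (if ∷ ifs) (e≁f ∷ e≁fs) = (e≁f ∘ other-SameEdge v e _ ie if) ∷ distinct-from-e ifs e≁fs

  ∑-neighbours : (g : Fin n → Fin n → ℕ) →
    ∑ (allFin n) (λ v → ∑ (neighbours v) (g v)) ≡ ∑ E (λ e → g (proj₁ e) (proj₂ e) + g (proj₂ e) (proj₁ e))
  ∑-neighbours g = trans (∑-cong (allFin n) (λ {v} _ → ∑-map (filter (incident? v) E) (other v) (g v)))
                         (double-count E loopless g)

  handshake : ∑ (allFin n) (length ∘ neighbours) ≡ 2 * length E
  handshake = begin
    ∑ (allFin n) (length ∘ neighbours)                    ≡⟨ ∑-cong (allFin n) (λ {v} _ → sym (∑-one (neighbours v))) ⟩
    ∑ (allFin n) (λ v → ∑ (neighbours v) (λ _ → 1))       ≡⟨ ∑-neighbours (λ _ _ → 1) ⟩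
    ∑ E (λ _ → 2)                                         ≡⟨ ∑-*-distribˡ E 2 (λ _ → 1) ⟩
    2 * ∑ E (λ _ → 1)                                     ≡⟨ cong (2 *_) (∑-one E) ⟩
    2 * length E                                          ∎
    where open ≡-Reasoning

module TreeGraph {n : ℕ} (t : Tree n) where

  open SimpleGraph (edges t) (simple t) public

  degree≡length-neighbours : ∀ v → degree t v ≡ length (neighbours v)
  degree≡length-neighbours v = sym (length-map (other v) (filter (incident? v) (edges t)))

  ∑-degree : ∑ (allFin n) (degree t) ≡ 2 * length (edges t)
  ∑-degree = trans (∑-cong (allFin n) (λ {v} _ → degree≡length-neighbours v)) handshake

module IndexOf {A : Set} (_≟ᴬ_ : DecidableEquality A) where

  indexOf : A → List A → ℕ
  indexOf x []       = 0
  indexOf x (y ∷ ys) with x ≟ᴬ y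
  ... | yes _ = 0
  ... | no  _ = suc (indexOf x ys)

  indexOf-here : ∀ x ys → indexOf x (x ∷ ys) ≡ 0
  indexOf-here x ys with x ≟ᴬ x
  ... | yes _   = refl
  ... | no  x≢x = ⊥-elim (x≢x refl)

  indexOf-there : ∀ {x y} ys → x ≢ y → indexOf x (y ∷ ys) ≡ suc (indexOf x ys)
  indexOf-there {x} {y} ys x≢y with x ≟ᴬ y
  ... | yes x≡y = ⊥-elim (x≢y x≡y)
  ... | no  _   = refl

  indexOf-injective : ∀ {x y xs} → y ∈ xs → indexOf x xs ≡ indexOf y xs → x ≡ y
  indexOf-injective {x} {y} {z ∷ zs} y∈ eq with x ≟ᴬ z | y ≟ᴬ z
  ... | yes x≡z | yes y≡z = trans x≡z (sym y≡z)
  ... | yes _   | no  _   = ⊥-elim (1+n≢0 (sym eq))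
  ... | no  _   | yes _   = ⊥-elim (1+n≢0 eq)
  indexOf-injective {x} {y} {z ∷ zs} (here y≡z)  eq | no _ | no y≢z = ⊥-elim (y≢z y≡z)
  indexOf-injective {x} {y} {z ∷ zs} (there y∈) eq | no _ | no _   = indexOf-injective y∈ (suc-injective eq)

  Consecutive⇒∈ : ∀ {xs : List A} {a b} → Consecutive xs a b → a ∈ xs × b ∈ xs
  Consecutive⇒∈ here      = here refl , there (here refl)
  Consecutive⇒∈ (there c) = let (a∈ , b∈) = Consecutive⇒∈ c in there a∈ , there b∈

  Consecutive⇒indexOf : ∀ {xs : List A} {a b} → Unique xs → Consecutive xs a b → indexOf b xs ≡ suc (indexOf a xs)
  Consecutive⇒indexOf {a ∷ b ∷ zs} ((a≢b ∷ _) ∷ _) here = begin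
    indexOf b (a ∷ b ∷ zs)       ≡⟨ indexOf-there (b ∷ zs) (a≢b ∘ sym) ⟩
    suc (indexOf b (b ∷ zs))     ≡⟨ cong suc (indexOf-here b zs) ⟩
    1                            ≡⟨ cong suc (indexOf-here a (b ∷ zs)) ⟨
    suc (indexOf a (a ∷ b ∷ zs)) ∎
    where open ≡-Reasoning
  Consecutive⇒indexOf {x ∷ xs} {a} {b} (x∉ ∷ u) (there c) = begin
    indexOf b (x ∷ xs)           ≡⟨ indexOf-there xs (λ b≡x → All.lookup x∉ b∈ (sym b≡x)) ⟩
    suc (indexOf b xs)           ≡⟨ cong suc (Consecutive⇒indexOf u c) ⟩
    suc (suc (indexOf a xs))     ≡⟨ cong suc (indexOf-there xs (λ a≡x → All.lookup x∉ a∈ (sym a≡x))) ⟨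
    suc (indexOf a (x ∷ xs))     ∎
    where
      open ≡-Reasoning
      a∈ = proj₁ (Consecutive⇒∈ c)
      b∈ = proj₂ (Consecutive⇒∈ c)

  ∑-indexOf : ∀ {xs} (g : ℕ → ℕ) → Unique xs → ∑ xs (λ x → g (indexOf x xs)) ≡ ∑< (length xs) g
  ∑-indexOf {[]}     g u          = refl
  ∑-indexOf {x ∷ xs} g (x∉ ∷ u) = cong₂ _+_ (cong g (indexOf-here x xs)) (begin
    ∑ xs (λ y → g (indexOf y (x ∷ xs)))    ≡⟨ ∑-cong xs (λ y∈ → cong g (indexOf-there xs (λ y≡x → All.lookup x∉ y∈ (sym y≡x)))) ⟩
    ∑ xs (λ y → g (suc (indexOf y xs)))    ≡⟨ ∑-indexOf (g ∘ suc) u ⟩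
    ∑< (length xs) (g ∘ suc)               ∎)
    where open ≡-Reasoning

parity-suc : ∀ k → parity (suc k) ≡ parity k ⁻¹
parity-suc k = sym (⁻¹-selfInverse (suc-homo-⁻¹ k))

DifferByOne⇒parity : ∀ {a b} → DifferByOne a b → parity b ≡ parity a ⁻¹
DifferByOne⇒parity {a}     (inj₁ refl) = parity-suc a
DifferByOne⇒parity {b = b} (inj₂ refl) = sym (suc-homo-⁻¹ b)

¬DifferByOne-triangle : ∀ {a b c} → DifferByOne a b → DifferByOne b c → ¬ DifferByOne a c
¬DifferByOne-triangle {a} {b} {c} ab bc ac = p≢p⁻¹ (parity a) (begin
  parity a           ≡⟨ ⁻¹-involutive (parity a) ⟨
  parity a ⁻¹ ⁻¹     ≡⟨ cong _⁻¹ (DifferByOne⇒parity ab) ⟨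
  parity b ⁻¹        ≡⟨ DifferByOne⇒parity bc ⟨
  parity c           ≡⟨ DifferByOne⇒parity ac ⟩
  parity a ⁻¹        ∎)
  where open ≡-Reasoning

2≤length : ∀ {A : Set} {xs : List A} {x y} → x ∈ xs → y ∈ xs → x ≢ y → 2 ≤ length xs
2≤length (here refl)                (here refl)                x≢y = ⊥-elim (x≢y refl)
2≤length (here refl)                (there {xs = _ ∷ _} y∈)   x≢y = s≤s (s≤s z≤n)
2≤length (there {xs = _ ∷ _} x∈)   (here refl)                x≢y = s≤s (s≤s z≤n)
2≤length (there x∈)                 (there y∈)                 x≢y = m≤n⇒m≤1+n (2≤length x∈ y∈ x≢y)

module Caterpillar {n : ℕ} (t : Tree n) (cat : IsCaterpillar t) where

  open TreeGraph t public
  open IndexOf (_≟_ {n}) public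

  spine : List (Fin n)
  spine = proj₁ cat

  spine-unique : Unique spine
  spine-unique = proj₁ (proj₂ cat)

  ∈spine⇒¬Leaf : ∀ {v} → v ∈ spine → ¬ Leaf t v
  ∈spine⇒¬Leaf {v} = proj₁ (proj₁ (proj₂ (proj₂ cat)) v)

  ¬Leaf⇒∈spine : ∀ {v} → ¬ Leaf t v → v ∈ spine
  ¬Leaf⇒∈spine {v} = proj₂ (proj₁ (proj₂ (proj₂ cat)) v)

  spine-index : Fin n → ℕ
  spine-index v = indexOf v spine

  spine-adjacent : ∀ {u v} → u ∈ spine → v ∈ spine → v ∈ neighbours u → DifferByOne (spine-index u) (spine-index v)
  spine-adjacent {u} {v} u∈ v∈ v∈N with proj₁ (proj₂ (proj₂ (proj₂ cat)) u v u∈ v∈) (∈neighbours⇒Adj v∈N)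
  ... | inj₁ uv = inj₁ (Consecutive⇒indexOf spine-unique uv)
  ... | inj₂ vu = inj₂ (Consecutive⇒indexOf spine-unique vu)

  two-neighbours⇒∈spine : ∀ {x y z} → y ∈ neighbours x → z ∈ neighbours x → y ≢ z → x ∈ spine
  two-neighbours⇒∈spine {x} y∈ z∈ y≢z = ¬Leaf⇒∈spine λ leaf →
    <-irrefl refl (≤-trans (2≤length y∈ z∈ y≢z) (≤-reflexive (trans (sym (degree≡length-neighbours x)) leaf)))

  no-triangle : TriangleFree
  no-triangle {u} {v} {w} v∈u w∈u w∈v =
    ¬DifferByOne-triangle (spine-adjacent u∈ v∈ v∈u) (spine-adjacent v∈ w∈ w∈v) (spine-adjacent u∈ w∈ w∈u)
    where
      u∈ = two-neighbours⇒∈spine v∈u w∈u (neighbours-≢ w∈v)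
      v∈ = two-neighbours⇒∈spine (neighbours-sym v∈u) w∈v (neighbours-≢ w∈u)
      w∈ = two-neighbours⇒∈spine (neighbours-sym w∈u) (neighbours-sym w∈v) (neighbours-≢ v∈u)

-- Bounds on the cost of an arrangement of a simple graph

module Cost {n : ℕ} (E : List (Edge n)) (simple : Simple E) (π : Permutation′ n) where

  open SimpleGraph E simple
  open Positions π

  cost : ℕ
  cost = ∑ E (λ e → ∣ pos (proj₁ e) - pos (proj₂ e) ∣)

  gap : Edge n → ℕ
  gap e = ∑ (allFin n) (λ w → between (pos (proj₁ e)) (pos (proj₂ e)) (pos w))

  cost≡edges+gaps : cost ≡ length E + ∑ E gap
  cost≡edges+gaps = begin
    cost                          ≡⟨ ∑-cong E (λ e∈ → ∣pos-pos∣≡1+∑-between (loopless e∈)) ⟩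
    ∑ E (λ e → 1 + gap e)         ≡⟨ ∑-distrib-+ E (λ _ → 1) gap ⟩
    ∑ E (λ _ → 1) + ∑ E gap       ≡⟨ cong (_+ ∑ E gap) (∑-one E) ⟩
    length E + ∑ E gap            ∎
    where open ≡-Reasoning

  nested : Fin n → Fin n → ℕ
  nested v u = ∑ (neighbours v) (λ w → between (pos v) (pos u) (pos w))

  nestedAt : Fin n → ℕ
  nestedAt v = enclosed (pos v) (map pos (neighbours v))

  ∑-nested : ∑ E (λ e → nested (proj₁ e) (proj₂ e) + nested (proj₂ e) (proj₁ e)) ≡ ∑ (allFin n) nestedAt
  ∑-nested = begin
    ∑ E (λ e → nested (proj₁ e) (proj₂ e) + nested (proj₂ e) (proj₁ e))  ≡⟨ ∑-neighbours nested ⟨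
    ∑ (allFin n) (λ v → ∑ (neighbours v) (nested v))                       ≡⟨ ∑-cong (allFin n) (λ {v} _ → nested-map v) ⟩
    ∑ (allFin n) nestedAt                                                   ∎
    where
      open ≡-Reasoning
      nested-map : ∀ v → ∑ (neighbours v) (nested v) ≡ nestedAt v
      nested-map v = trans (∑-cong (neighbours v) (λ {u} _ → sym (∑-map (neighbours v) pos (between (pos v) (pos u)))))
                           (sym (∑-map (neighbours v) pos (λ x → ∑ (map pos (neighbours v)) (between (pos v) x))))

  nested-sym : ∀ u v → nested v u ≡ ∑ (neighbours v) (λ w → between (pos u) (pos v) (pos w))
  nested-sym u v = ∑-cong (neighbours v) (λ {w} _ → between-comm (pos v) (pos u) (pos w))

  pos-neighbours-unique : ∀ v → Unique (map pos (neighbours v))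
  pos-neighbours-unique v = Unique.map⁺ pos-injective (neighbours-unique v)

  pos∉pos-neighbours : ∀ v → pos v ∉ map pos (neighbours v)
  pos∉pos-neighbours v pv∈ with u , u∈ , pv≡pu ← ∈-map⁻ pos pv∈ = neighbours-≢ u∈ (pos-injective pv≡pu)

  length-pos-neighbours : ∀ v → length (map pos (neighbours v)) ≡ length (neighbours v)
  length-pos-neighbours v = length-map pos (neighbours v)

  quarterSquares≤gaps : TriangleFree → ∑ (allFin n) (quarterSquare ∘ length ∘ neighbours) ≤ ∑ E gap
  quarterSquares≤gaps triangle-free = begin
    ∑ (allFin n) (quarterSquare ∘ length ∘ neighbours)
      ≤⟨ ∑-mono-≤ (allFin n) (λ {v} _ → subst (λ k → quarterSquare k ≤ nestedAt v) (length-pos-neighbours v)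
           (quarterSquare≤enclosed (pos v) (map pos (neighbours v)) (pos-neighbours-unique v) (pos∉pos-neighbours v))) ⟩
    ∑ (allFin n) nestedAt
      ≡⟨ ∑-nested ⟨
    ∑ E (λ e → nested (proj₁ e) (proj₂ e) + nested (proj₂ e) (proj₁ e))
      ≤⟨ ∑-mono-≤ E nested≤gap ⟩
    ∑ E gap ∎
    where
      open ≤-Reasoning
      nested≤gap : ∀ {e} → e ∈ E → nested (proj₁ e) (proj₂ e) + nested (proj₂ e) (proj₁ e) ≤ gap e
      nested≤gap {a , b} e∈ = begin
        nested a b + nested b a
          ≡⟨ cong (nested a b +_) (nested-sym a b) ⟩
        nested a b + ∑ (neighbours b) (λ w → between (pos a) (pos b) (pos w))
          ≡⟨ ∑-++ (neighbours a) (neighbours b) _ ⟨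
        ∑ (neighbours a ++ neighbours b) (λ w → between (pos a) (pos b) (pos w))
          ≤⟨ ∑-⊆ _≟_ (allFin n) _ (Unique.++⁺ (neighbours-unique a) (neighbours-unique b) disjoint) (λ {x} _ → ∈-allFin x) ⟩
        gap (a , b) ∎
        where
          b∈a = Adj⇒∈neighbours (inj₁ e∈)
          disjoint : ∀ {w} → ¬ (w ∈ neighbours a × w ∈ neighbours b)
          disjoint (w∈a , w∈b) = triangle-free b∈a w∈a w∈b

  IntervalsCovered : Set
  IntervalsCovered = ∀ {u v w} → v ∈ neighbours u → pos u < pos w → pos w < pos v →
                     w ∈ neighbours u ⊎ w ∈ neighbours v

  BalancedAt : Fin n → Set
  BalancedAt v = Balanced (left (pos v) (map pos (neighbours v))) (right (pos v) (map pos (neighbours v)))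

  gaps≤quarterSquares : IntervalsCovered → (∀ v → BalancedAt v) →
                        ∑ E gap ≤ ∑ (allFin n) (quarterSquare ∘ length ∘ neighbours)
  gaps≤quarterSquares covered balanced = begin
    ∑ E gap
      ≤⟨ ∑-mono-≤ E gap≤nested ⟩
    ∑ E (λ e → nested (proj₁ e) (proj₂ e) + nested (proj₂ e) (proj₁ e))
      ≡⟨ ∑-nested ⟩
    ∑ (allFin n) nestedAt
      ≡⟨ ∑-cong (allFin n) (λ {v} _ → trans (enclosed≡quarterSquare (pos v) (map pos (neighbours v))
                                               (pos-neighbours-unique v) (pos∉pos-neighbours v) (balanced v))
                                             (cong quarterSquare (length-pos-neighbours v))) ⟩
    ∑ (allFin n) (quarterSquare ∘ length ∘ neighbours) ∎
    where
      open ≤-Reasoning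
      gap≤nested : ∀ {e} → e ∈ E → gap e ≤ nested (proj₁ e) (proj₂ e) + nested (proj₂ e) (proj₁ e)
      gap≤nested {a , b} e∈ = begin
        gap (a , b)
          ≤⟨ ∑-support-⊆ _≟_ (neighbours a ++ neighbours b) _ (Unique.allFin⁺ n) (λ _ → covered-by-ends) ⟩
        ∑ (neighbours a ++ neighbours b) (λ w → between (pos a) (pos b) (pos w))
          ≡⟨ ∑-++ (neighbours a) (neighbours b) _ ⟩
        nested a b + ∑ (neighbours b) (λ w → between (pos a) (pos b) (pos w))
          ≡⟨ cong (nested a b +_) (nested-sym a b) ⟨
        nested a b + nested b a ∎
        where
          b∈a = Adj⇒∈neighbours (inj₁ e∈)
          covered-by-ends : ∀ {w} → between (pos a) (pos b) (pos w) ≢ 0 → w ∈ neighbours a ++ neighbours b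
          covered-by-ends ne with between≢0⇒ ne
          ... | inj₁ (a<w , w<b) = [ ∈-++⁺ˡ , ∈-++⁺ʳ (neighbours a) ] (covered b∈a a<w w<b)
          ... | inj₂ (b<w , w<a) = [ ∈-++⁺ʳ (neighbours a) , ∈-++⁺ˡ ] (covered (neighbours-sym b∈a) b<w w<a)

-- Arranging vertices in increasing order of a key

injective⇒surjective : ∀ {n} (f : Fin n → Fin n) → (∀ {x y} → f x ≡ f y → x ≡ y) → ∀ i → ∃ λ w → f w ≡ i
injective⇒surjective {suc m} f f-injective i with any? (λ w → f w ≟ i)
... | yes hit = hit
... | no  ¬hit = ⊥-elim (<-irrefl refl (injective⇒≤ {f = f-avoiding-i} f-avoiding-i-injective))
  where
    f≢i : ∀ w → i ≢ f w
    f≢i w i≡fw = ¬hit (w , sym i≡fw)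
    f-avoiding-i : Fin (suc m) → Fin m
    f-avoiding-i w = punchOut (f≢i w)
    f-avoiding-i-injective : ∀ {x y} → f-avoiding-i x ≡ f-avoiding-i y → x ≡ y
    f-avoiding-i-injective eq = f-injective (punchOut-injective (f≢i _) (f≢i _) eq)

module RankBy {n : ℕ} (K : Fin n → ℕ) where

  infix 4 _≺_ _≺?_

  _≺_ : Fin n → Fin n → Set
  x ≺ y = K x < K y ⊎ (K x ≡ K y × toℕ x < toℕ y)

  _≺?_ : ∀ x y → Dec (x ≺ y)
  x ≺? y = (K x <? K y) ⊎-dec ((K x ℕ.≟ K y) ×-dec (toℕ x <? toℕ y))

  ≺-irrefl : ∀ {x} → ¬ x ≺ x
  ≺-irrefl (inj₁ Kx<Kx)       = <-irrefl refl Kx<Kx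
  ≺-irrefl (inj₂ (_ , x<x)) = <-irrefl refl x<x

  ≺-trans : ∀ {x y z} → x ≺ y → y ≺ z → x ≺ z
  ≺-trans (inj₁ p)        (inj₁ q)         = inj₁ (<-trans p q)
  ≺-trans (inj₁ p)        (inj₂ (e , _))   = inj₁ (<-≤-trans p (≤-reflexive e))
  ≺-trans (inj₂ (e , _))  (inj₁ q)         = inj₁ (≤-<-trans (≤-reflexive e) q)
  ≺-trans (inj₂ (e , p))  (inj₂ (e′ , q))  = inj₂ (trans e e′ , <-trans p q)

  ≺-asym : ∀ {x y} → x ≺ y → ¬ y ≺ x
  ≺-asym x≺y y≺x = ≺-irrefl (≺-trans x≺y y≺x)

  ≺-connex : ∀ {x y} → x ≢ y → x ≺ y ⊎ y ≺ x
  ≺-connex {x} {y} x≢y with <-cmp (K x) (K y) | <-cmp (toℕ x) (toℕ y)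
  ... | tri< Kx<Ky _ _  | _              = inj₁ (inj₁ Kx<Ky)
  ... | tri> _ _ Ky<Kx  | _              = inj₂ (inj₁ Ky<Kx)
  ... | tri≈ _ Kx≡Ky _ | tri< x<y _ _   = inj₁ (inj₂ (Kx≡Ky , x<y))
  ... | tri≈ _ Kx≡Ky _ | tri> _ _ y<x   = inj₂ (inj₂ (sym Kx≡Ky , y<x))
  ... | tri≈ _ _ _      | tri≈ _ x≡y _  = ⊥-elim (x≢y (toℕ-injective x≡y))

  ≺⇒K≤ : ∀ {x y} → x ≺ y → K x ≤ K y
  ≺⇒K≤ (inj₁ Kx<Ky)     = <⇒≤ Kx<Ky
  ≺⇒K≤ (inj₂ (Kx≡Ky , _)) = ≤-reflexive Kx≡Ky

  rank : Fin n → ℕ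
  rank w = ∑ (allFin n) (λ x → 𝟙 (x ≺? w))

  rank-mono : ∀ {x y} → x ≺ y → rank x < rank y
  rank-mono {x} {y} x≺y = ∑-mono-< (λ z → 𝟙 (z ≺? x)) (λ z → 𝟙 (z ≺? y)) below-x (∈-allFin x)
    (≤-trans (s≤s (≤-reflexive (𝟙-no (x ≺? x) ≺-irrefl))) (≤-reflexive (sym (𝟙-yes (x ≺? y) x≺y))))
    where
      below-x : ∀ {z} → z ∈ allFin n → 𝟙 (z ≺? x) ≤ 𝟙 (z ≺? y)
      below-x {z} _ with z ≺? x
      ... | no  _   = z≤n
      ... | yes z≺x = ≤-reflexive (sym (𝟙-yes (z ≺? y) (≺-trans z≺x x≺y)))

  rank<n : ∀ w → rank w < n
  rank<n w = begin-strict
    rank w                      <⟨ ∑-mono-< (λ x → 𝟙 (x ≺? w)) (λ _ → 1) (λ {x} _ → 𝟙-≤-1 (x ≺? w)) (∈-allFin w)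
                                           (≤-reflexive (cong suc (𝟙-no (w ≺? w) ≺-irrefl))) ⟩
    ∑ (allFin n) (λ _ → 1)      ≡⟨ ∑-one (allFin n) ⟩
    length (allFin n)           ≡⟨ length-tabulate (λ i → i) ⟩
    n                           ∎
    where open ≤-Reasoning

  rank-injective : ∀ {x y} → rank x ≡ rank y → x ≡ y
  rank-injective {x} {y} eq with x ≟ y
  ... | yes x≡y = x≡y
  ... | no  x≢y with ≺-connex x≢y
  ...   | inj₁ x≺y = ⊥-elim (<-irrefl eq (rank-mono x≺y))
  ...   | inj₂ y≺x = ⊥-elim (<-irrefl (sym eq) (rank-mono y≺x))

  private
    rankFin : Fin n → Fin n
    rankFin w = fromℕ< (rank<n w)

    rankFin-injective : ∀ {x y} → rankFin x ≡ rankFin y → x ≡ y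
    rankFin-injective {x} {y} eq =
      rank-injective (trans (sym (toℕ-fromℕ< (rank<n x))) (trans (cong toℕ eq) (toℕ-fromℕ< (rank<n y))))

    unrank : Fin n → Fin n
    unrank i = proj₁ (injective⇒surjective rankFin rankFin-injective i)

  arrangement : Permutation′ n
  arrangement = permutation rankFin unrank
    (λ i → proj₂ (injective⇒surjective rankFin rankFin-injective i))
    (λ w → rankFin-injective (proj₂ (injective⇒surjective rankFin rankFin-injective (rankFin w))))

  open Positions arrangement using (pos)

  pos≡rank : ∀ w → pos w ≡ rank w
  pos≡rank w = toℕ-fromℕ< (rank<n w)

  ≺⇒pos< : ∀ {x y} → x ≺ y → pos x < pos y
  ≺⇒pos< {x} {y} x≺y = subst₂ _<_ (sym (pos≡rank x)) (sym (pos≡rank y)) (rank-mono x≺y)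

  pos<⇒≺ : ∀ {x y} → pos x < pos y → x ≺ y
  pos<⇒≺ {x} {y} px<py with x ≟ y
  ... | yes refl = ⊥-elim (<-irrefl refl px<py)
  ... | no  x≢y with ≺-connex x≢y
  ...   | inj₁ x≺y = x≺y
  ...   | inj₂ y≺x = ⊥-elim (<-asym px<py (≺⇒pos< y≺x))

-- An optimal arrangement of a caterpillar

headOr : {A : Set} → A → List A → A
headOr d []      = d
headOr d (x ∷ _) = x

∈-length≡1⇒≡headOr : ∀ {A : Set} {xs : List A} {x} d → length xs ≡ 1 → x ∈ xs → x ≡ headOr d xs
∈-length≡1⇒≡headOr {xs = _ ∷ []} d _ (here refl) = refl

headOr-∈ : ∀ {A : Set} {xs : List A} d → length xs ≡ 1 → headOr d xs ∈ xs
headOr-∈ {xs = _ ∷ []} d _ = here refl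

3*+<3*+ : ∀ {i j} r s → i < j → r ≤ 2 → 3 * i + r < 3 * j + s
3*+<3*+ {i} {j} r s i<j r≤2 = begin-strict
  3 * i + r   ≤⟨ +-monoʳ-≤ (3 * i) r≤2 ⟩
  3 * i + 2   <⟨ +-monoʳ-< (3 * i) (n<1+n 2) ⟩
  3 * i + 3   ≡⟨ trans (+-comm (3 * i) 3) (sym (*-suc 3 i)) ⟩
  3 * suc i   ≤⟨ *-monoʳ-≤ 3 i<j ⟩
  3 * j       ≤⟨ m≤m+n (3 * j) s ⟩
  3 * j + s   ∎
  where open ≤-Reasoning

3*+1-reflect-≤ : ∀ {a b} → 3 * a + 1 ≤ 3 * b + 1 → a ≤ b
3*+1-reflect-≤ le = ≮⇒≥ (λ b<a → <⇒≱ (3*+<3*+ 1 1 b<a (s≤s z≤n)) le)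

same-block : ∀ {i j} r → r ≤ 2 → 3 * i + 0 ≤ 3 * j + r → 3 * j + r ≤ 3 * i + 2 → j ≡ i
same-block {i} {j} r r≤2 lo hi with <-cmp j i
... | tri< j<i _ _ = ⊥-elim (<⇒≱ (3*+<3*+ r 0 j<i r≤2) lo)
... | tri≈ _ j≡i _ = j≡i
... | tri> _ _ i<j = ⊥-elim (<⇒≱ (3*+<3*+ 2 r i<j ≤-refl) hi)

adjacent-blocks : ∀ {i j} r → r ≤ 2 → 3 * i + 1 ≤ 3 * j + r → 3 * j + r ≤ 3 * suc i + 1 → j ≡ i ⊎ j ≡ suc i
adjacent-blocks {i} {j} r r≤2 lo hi with <-cmp j i | <-cmp j (suc i)
... | tri< j<i _ _ | _               = ⊥-elim (<⇒≱ (3*+<3*+ r 1 j<i r≤2) lo)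
... | tri≈ _ j≡i _ | _               = inj₁ j≡i
... | tri> _ _ i<j | tri< j<1+i _ _  = ⊥-elim (<⇒≱ i<j (<⇒≤pred j<1+i))
... | tri> _ _ _   | tri≈ _ j≡1+i _  = inj₂ j≡1+i
... | tri> _ _ _   | tri> _ _ 1+i<j  = ⊥-elim (<⇒≱ (3*+<3*+ 1 r 1+i<j (s≤s z≤n)) hi)

isEven isOdd : Parity → ℕ
isEven 0ℙ = 1
isEven 1ℙ = 0
isOdd  0ℙ = 0
isOdd  1ℙ = 1

alternation : ∀ m k → ∑< m (λ j → isEven (parity (j + k))) + isOdd (parity k)
                    ≡ ∑< m (λ j → isOdd (parity (j + k))) + isOdd (parity (m + k))
alternation zero    k = refl
alternation (suc m) k = begin
  ∑< (suc m) evens + isOdd (parity k)          ≡⟨ cong (_+ isOdd (parity k)) (∑<-suc evens m) ⟩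
  (∑< m evens + isEven p) + isOdd (parity k)   ≡⟨ +-right-comm (∑< m evens) (isEven p) (isOdd (parity k)) ⟩
  (∑< m evens + isOdd (parity k)) + isEven p   ≡⟨ cong (_+ isEven p) (alternation m k) ⟩
  (∑< m odds + isOdd p) + isEven p             ≡⟨ +-assoc (∑< m odds) (isOdd p) (isEven p) ⟩
  ∑< m odds + (isOdd p + isEven p)             ≡⟨ cong (λ q → ∑< m odds + (isOdd p + q)) (flip-parity p) ⟩
  ∑< m odds + (isOdd p + isOdd (p ⁻¹))         ≡⟨ +-assoc (∑< m odds) (isOdd p) (isOdd (p ⁻¹)) ⟨
  (∑< m odds + isOdd p) + isOdd (p ⁻¹)         ≡⟨ cong₂ _+_ (∑<-suc odds m) (cong isOdd (parity-suc (m + k))) ⟨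
  ∑< (suc m) odds + isOdd (parity (suc m + k)) ∎
  where
    open ≡-Reasoning
    evens odds : ℕ → ℕ
    evens j = isEven (parity (j + k))
    odds  j = isOdd (parity (j + k))
    p = parity (m + k)
    flip-parity : ∀ p → isEven p ≡ isOdd (p ⁻¹)
    flip-parity 0ℙ = refl
    flip-parity 1ℙ = refl
    +-right-comm : ∀ a b c → (a + b) + c ≡ (a + c) + b
    +-right-comm = solve-∀

isOdd-parity : ∀ {k} → k ≤ 1 → isOdd (parity k) ≡ k
isOdd-parity z≤n       = refl
isOdd-parity (s≤s z≤n) = refl

isOdd≤1 : ∀ p → isOdd p ≤ 1
isOdd≤1 0ℙ = z≤n
isOdd≤1 1ℙ = s≤s z≤n

Balanced-+ : ∀ {a o b r} → a ≡ o + b → b ≤ 1 → r ≤ 1 → Balanced a (r + o)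
Balanced-+ {o = o} {0} {0} refl _ _ = inj₁ (+-identityʳ o)
Balanced-+ {o = o} {0} {1} refl _ _ = inj₂ (inj₁ (cong suc (sym (+-identityʳ o))))
Balanced-+ {o = o} {1} {0} refl _ _ = inj₂ (inj₂ (+-comm o 1))
Balanced-+ {o = o} {1} {1} refl _ _ = inj₁ (+-comm o 1)
Balanced-+ {b = 2+ _} _ (s≤s ()) _
Balanced-+ {r = 2+ _} _ _ (s≤s ())

+≡1⇒Balanced : ∀ {a b} → a + b ≡ 1 → Balanced a b
+≡1⇒Balanced {0} {1} _ = inj₂ (inj₁ refl)
+≡1⇒Balanced {1} {0} _ = inj₂ (inj₂ refl)
+≡1⇒Balanced {0} {0} ()
+≡1⇒Balanced {0} {2+ _} ()
+≡1⇒Balanced {1} {suc _} ()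
+≡1⇒Balanced {2+ _} ()

sideOf : Parity → ℕ
sideOf 0ℙ = 0
sideOf 1ℙ = 2

module CaterpillarArrangement {n : ℕ} (t : Tree n) (cat : IsCaterpillar t) where

  open Caterpillar t cat public

  leaf? : ∀ v → Dec (Leaf t v)
  leaf? v = degree t v ℕ.≟ 1

  length-neighbours-leaf : ∀ {w} → Leaf t w → length (neighbours w) ≡ 1
  length-neighbours-leaf {w} leaf = trans (sym (degree≡length-neighbours w)) leaf

  anchor : Fin n → Fin n
  anchor w = headOr w (neighbours w)

  anchor-∈ : ∀ {w} → Leaf t w → anchor w ∈ neighbours w
  anchor-∈ {w} leaf = headOr-∈ w (length-neighbours-leaf leaf)

  ∈neighbours-leaf : ∀ {w x} → Leaf t w → x ∈ neighbours w → x ≡ anchor w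
  ∈neighbours-leaf {w} leaf = ∈-length≡1⇒≡headOr w (length-neighbours-leaf leaf)

  -- The only use of connectedness: a tree with an edge between two leaves is that edge.
  leaf-edge-spans : ∀ {u v} → Leaf t u → Leaf t v → v ∈ neighbours u → ∀ x → x ≡ u ⊎ x ≡ v
  leaf-edge-spans {u} {v} lu lv v∈u x = reach (connected t x u) (inj₁ refl)
    where
      step : ∀ {x y} → Adj (edges t) x y → y ≡ u ⊎ y ≡ v → x ≡ u ⊎ x ≡ v
      step x~u (inj₁ refl) = inj₂ (trans (∈neighbours-leaf lu (Adj⇒∈neighbours (Adj-sym x~u)))
                                         (sym (∈neighbours-leaf lu v∈u)))
      step x~v (inj₂ refl) = inj₁ (trans (∈neighbours-leaf lv (Adj⇒∈neighbours (Adj-sym x~v)))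
                                         (sym (∈neighbours-leaf lv (neighbours-sym v∈u))))
      reach : ∀ {x y} → Star (Adj (edges t)) x y → y ≡ u ⊎ y ≡ v → x ≡ u ⊎ x ≡ v
      reach ε          y∈uv = y∈uv
      reach (x~z ◅ zy) y∈uv = step x~z (reach zy y∈uv)

  leafNeighbours spineNeighbours : Fin n → List (Fin n)
  leafNeighbours  v = filter leaf? (neighbours v)
  spineNeighbours v = filter (¬? ∘ leaf?) (neighbours v)

  spineBelow spineAbove : Fin n → ℕ
  spineBelow v = ∑ (spineNeighbours v) (λ x → 𝟙 (spine-index x <? spine-index v))
  spineAbove v = ∑ (spineNeighbours v) (λ x → 𝟙 (spine-index v <? spine-index x))

  leafParity : Fin n → Parity
  leafParity w = parity (indexOf w (leafNeighbours (anchor w)) + spineBelow (anchor w))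

  home : Fin n → Fin n
  home w with leaf? w
  ... | yes _ = anchor w
  ... | no  _ = w

  offset : Fin n → ℕ
  offset w with leaf? w
  ... | yes _ = sideOf (leafParity w)
  ... | no  _ = 1

  -- The i-th spine vertex gets key 3i + 1 and its leaves get 3i or 3i + 2. Its leaves alternate
  -- sides, the first going right exactly when it has a spine neighbour before it, so that its
  -- neighbourhood is split evenly.
  key : Fin n → ℕ
  key w = 3 * spine-index (home w) + offset w

  open RankBy key public

  home-leaf : ∀ {w} → Leaf t w → home w ≡ anchor w
  home-leaf {w} leaf with leaf? w
  ... | yes _     = refl
  ... | no  ¬leaf = ⊥-elim (¬leaf leaf)

  home-spine : ∀ {w} → ¬ Leaf t w → home w ≡ w
  home-spine {w} ¬leaf with leaf? w
  ... | yes leaf = ⊥-elim (¬leaf leaf)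
  ... | no  _    = refl

  offset-leaf : ∀ {w} → Leaf t w → offset w ≡ sideOf (leafParity w)
  offset-leaf {w} leaf with leaf? w
  ... | yes _     = refl
  ... | no  ¬leaf = ⊥-elim (¬leaf leaf)

  offset-spine : ∀ {w} → ¬ Leaf t w → offset w ≡ 1
  offset-spine {w} ¬leaf with leaf? w
  ... | yes leaf = ⊥-elim (¬leaf leaf)
  ... | no  _    = refl

  offset≤2 : ∀ w → offset w ≤ 2
  offset≤2 w with leaf? w
  ... | yes _ = sideOf≤2 (leafParity w)
    where
      sideOf≤2 : ∀ p → sideOf p ≤ 2
      sideOf≤2 0ℙ = z≤n
      sideOf≤2 1ℙ = ≤-refl
  ... | no  _ = s≤s z≤n

  key-spine : ∀ {s} → s ∈ spine → key s ≡ 3 * spine-index s + 1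
  key-spine s∈ = cong₂ (λ h o → 3 * spine-index h + o) (home-spine ¬leaf) (offset-spine ¬leaf)
    where ¬leaf = ∈spine⇒¬Leaf s∈

  key-leaf : ∀ {w v} → Leaf t w → v ∈ neighbours w → key w ≡ 3 * spine-index v + offset w
  key-leaf {w} leaf v∈ = cong (λ h → 3 * spine-index h + offset w) (trans (home-leaf leaf) (sym (∈neighbours-leaf leaf v∈)))

  ∈neighbours-home : ∀ {w} → Leaf t w → w ∈ neighbours (home w)
  ∈neighbours-home {w} leaf = subst (λ h → w ∈ neighbours h) (sym (home-leaf leaf)) (neighbours-sym (anchor-∈ leaf))

  home-in-block : ∀ {s w} → s ∈ spine → 3 * spine-index s + 0 ≤ key w → key w ≤ 3 * spine-index s + 2 → home w ≡ s
  home-in-block {w = w} s∈ lo hi = indexOf-injective s∈ (same-block (offset w) (offset≤2 w) lo hi)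

  covered-by-home : ∀ {u v w} → home w ≡ u ⊎ home w ≡ v → u ≺ w → w ≺ v → w ∈ neighbours u ⊎ w ∈ neighbours v
  covered-by-home {u} {v} {w} home∈uv u≺w w≺v = by-kind (leaf? w)
    where
      by-kind : Dec (Leaf t w) → w ∈ neighbours u ⊎ w ∈ neighbours v
      by-kind (yes leaf) = [ (λ h≡u → inj₁ (subst (λ h → w ∈ neighbours h) h≡u (∈neighbours-home leaf)))
                           , (λ h≡v → inj₂ (subst (λ h → w ∈ neighbours h) h≡v (∈neighbours-home leaf))) ] home∈uv
      by-kind (no ¬leaf) = ⊥-elim ([ (λ h≡u → ≺-irrefl (subst (_≺ w) (trans (sym h≡u) (home-spine ¬leaf)) u≺w))
                                   , (λ h≡v → ≺-irrefl (subst (w ≺_) (trans (sym h≡v) (home-spine ¬leaf)) w≺v)) ] home∈uv)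

  module _ {u v w : Fin n} (v∈u : v ∈ neighbours u) (u≺w : u ≺ w) (w≺v : w ≺ v) where

    open ≤-Reasoning

    home-between-leaf-spine : Leaf t u → v ∈ spine → home w ≡ v
    home-between-leaf-spine lu v∈ = home-in-block v∈
      (begin
        3 * spine-index v + 0          ≤⟨ +-monoʳ-≤ (3 * spine-index v) z≤n ⟩
        3 * spine-index v + offset u   ≡⟨ key-leaf lu v∈u ⟨
        key u                          ≤⟨ ≺⇒K≤ u≺w ⟩
        key w                          ∎)
      (begin
        key w                          ≤⟨ ≺⇒K≤ w≺v ⟩
        key v                          ≡⟨ key-spine v∈ ⟩
        3 * spine-index v + 1          ≤⟨ +-monoʳ-≤ (3 * spine-index v) (s≤s z≤n) ⟩
        3 * spine-index v + 2          ∎)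

    home-between-spine-leaf : u ∈ spine → Leaf t v → home w ≡ u
    home-between-spine-leaf u∈ lv = home-in-block u∈
      (begin
        3 * spine-index u + 0          ≤⟨ +-monoʳ-≤ (3 * spine-index u) z≤n ⟩
        3 * spine-index u + 1          ≡⟨ key-spine u∈ ⟨
        key u                          ≤⟨ ≺⇒K≤ u≺w ⟩
        key w                          ∎)
      (begin
        key w                          ≤⟨ ≺⇒K≤ w≺v ⟩
        key v                          ≡⟨ key-leaf lv (neighbours-sym v∈u) ⟩
        3 * spine-index u + offset v   ≤⟨ +-monoʳ-≤ (3 * spine-index u) (offset≤2 v) ⟩
        3 * spine-index u + 2          ∎)

    home-between-spine : u ∈ spine → v ∈ spine → home w ≡ u ⊎ home w ≡ v
    home-between-spine u∈ v∈ = along-spine (spine-adjacent u∈ v∈ v∈u)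
      where
        key-u≤key-v : 3 * spine-index u + 1 ≤ 3 * spine-index v + 1
        key-u≤key-v = begin
          3 * spine-index u + 1          ≡⟨ key-spine u∈ ⟨
          key u                          ≤⟨ ≺⇒K≤ (≺-trans u≺w w≺v) ⟩
          key v                          ≡⟨ key-spine v∈ ⟩
          3 * spine-index v + 1          ∎
        along-spine : DifferByOne (spine-index u) (spine-index v) → home w ≡ u ⊎ home w ≡ v
        along-spine (inj₂ u-after-v) =
          ⊥-elim (<⇒≱ (3*+<3*+ 1 1 (≤-reflexive (sym u-after-v)) (s≤s z≤n)) key-u≤key-v)
        along-spine (inj₁ v-after-u) =
          ⊎-map (indexOf-injective u∈) (λ h≡1+u → indexOf-injective v∈ (trans h≡1+u (sym v-after-u)))
                (adjacent-blocks (offset w) (offset≤2 w)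
                  (≤-trans (≤-reflexive (sym (key-spine u∈))) (≺⇒K≤ u≺w))
                  (begin
                    key w                          ≤⟨ ≺⇒K≤ w≺v ⟩
                    key v                          ≡⟨ key-spine v∈ ⟩
                    3 * spine-index v + 1          ≡⟨ cong (λ j → 3 * j + 1) v-after-u ⟩
                    3 * suc (spine-index u) + 1    ∎))

    ≺-covered : w ∈ neighbours u ⊎ w ∈ neighbours v
    ≺-covered = by-kinds (leaf? u) (leaf? v)
      where
        by-kinds : Dec (Leaf t u) → Dec (Leaf t v) → w ∈ neighbours u ⊎ w ∈ neighbours v
        by-kinds (yes lu) (yes lv) =
          ⊥-elim ([ (λ w≡u → ≺-irrefl (subst (u ≺_) w≡u u≺w)) , (λ w≡v → ≺-irrefl (subst (_≺ v) w≡v w≺v)) ]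
                  (leaf-edge-spans lu lv v∈u w))
        by-kinds (yes lu)  (no ¬lv) = covered-by-home (inj₂ (home-between-leaf-spine lu (¬Leaf⇒∈spine ¬lv))) u≺w w≺v
        by-kinds (no ¬lu) (yes lv)  = covered-by-home (inj₁ (home-between-spine-leaf (¬Leaf⇒∈spine ¬lu) lv)) u≺w w≺v
        by-kinds (no ¬lu) (no ¬lv)  =
          covered-by-home (home-between-spine (¬Leaf⇒∈spine ¬lu) (¬Leaf⇒∈spine ¬lv)) u≺w w≺v

  below above : Fin n → ℕ
  below v = ∑ (neighbours v) (λ x → 𝟙 (x ≺? v))
  above v = ∑ (neighbours v) (λ x → 𝟙 (v ≺? x))

  below+above≡degree : ∀ v → below v + above v ≡ length (neighbours v)
  below+above≡degree v = begin
    below v + above v                                   ≡⟨ ∑-distrib-+ (neighbours v) _ _ ⟨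
    ∑ (neighbours v) (λ x → 𝟙 (x ≺? v) + 𝟙 (v ≺? x))   ≡⟨ ∑-cong (neighbours v) (λ x∈ → one-side (neighbours-≢ x∈ ∘ sym)) ⟩
    ∑ (neighbours v) (λ _ → 1)                          ≡⟨ ∑-one (neighbours v) ⟩
    length (neighbours v)                               ∎
    where
      open ≡-Reasoning
      one-side : ∀ {x} → x ≢ v → 𝟙 (x ≺? v) + 𝟙 (v ≺? x) ≡ 1
      one-side {x} x≢v with ≺-connex x≢v
      ... | inj₁ x≺v = cong₂ _+_ (𝟙-yes (x ≺? v) x≺v) (𝟙-no (v ≺? x) (≺-asym x≺v))
      ... | inj₂ v≺x = cong₂ _+_ (𝟙-no (x ≺? v) (≺-asym v≺x)) (𝟙-yes (v ≺? x) v≺x)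

  spine-neighbour : ∀ {v x} → x ∈ spineNeighbours v → x ∈ neighbours v × x ∈ spine
  spine-neighbour {v} x∈ = let (x∈N , ¬leaf) = ∈-filter⁻ (¬? ∘ leaf?) {xs = neighbours v} x∈ in x∈N , ¬Leaf⇒∈spine ¬leaf

  𝟙-≺-spine : ∀ {x y} → x ∈ spine → y ∈ spine → x ≢ y → 𝟙 (x ≺? y) ≡ 𝟙 (spine-index x <? spine-index y)
  𝟙-≺-spine {x} {y} x∈ y∈ x≢y = 𝟙-cong (x ≺? y) (spine-index x <? spine-index y)
    (λ x≺y → ≤∧≢⇒< (3*+1-reflect-≤ (subst₂ _≤_ (key-spine x∈) (key-spine y∈) (≺⇒K≤ x≺y))) (x≢y ∘ indexOf-injective y∈))
    (λ x<y → inj₁ (subst₂ _<_ (sym (key-spine x∈)) (sym (key-spine y∈)) (3*+<3*+ 1 1 x<y (s≤s z≤n))))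

  𝟙-≺-leaf : ∀ {x v} → v ∈ spine → Leaf t x → v ∈ neighbours x →
             𝟙 (x ≺? v) ≡ isEven (leafParity x) × 𝟙 (v ≺? x) ≡ isOdd (leafParity x)
  𝟙-≺-leaf {x} {v} v∈ leaf v∈x = sides (leafParity x) (trans (key-leaf leaf v∈x) (cong (3 * i +_) (offset-leaf leaf)))
    where
      i = spine-index v
      sides : ∀ p → key x ≡ 3 * i + sideOf p → 𝟙 (x ≺? v) ≡ isEven p × 𝟙 (v ≺? x) ≡ isOdd p
      sides 0ℙ kx = 𝟙-yes (x ≺? v) x≺v , 𝟙-no (v ≺? x) (≺-asym x≺v)
        where x≺v = inj₁ (subst₂ _<_ (sym kx) (sym (key-spine v∈)) (+-monoʳ-< (3 * i) (s≤s z≤n)))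
      sides 1ℙ kx = 𝟙-no (x ≺? v) (≺-asym v≺x) , 𝟙-yes (v ≺? x) v≺x
        where v≺x = inj₁ (subst₂ _<_ (sym (key-spine v∈)) (sym kx) (+-monoʳ-< (3 * i) ≤-refl))

  leafParity-at : ∀ {x v} → Leaf t x → v ∈ neighbours x → leafParity x ≡ parity (indexOf x (leafNeighbours v) + spineBelow v)
  leafParity-at {x} leaf v∈x = cong (λ a → parity (indexOf x (leafNeighbours a) + spineBelow a)) (sym (∈neighbours-leaf leaf v∈x))

  leafNeighbours-unique : ∀ v → Unique (leafNeighbours v)
  leafNeighbours-unique v = Unique.filter⁺ leaf? (neighbours-unique v)

  spineNeighbours-unique : ∀ v → Unique (spineNeighbours v)
  spineNeighbours-unique v = Unique.filter⁺ (¬? ∘ leaf?) (neighbours-unique v)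

  module _ {v : Fin n} (v∈ : v ∈ spine) where

    private
      m = length (leafNeighbours v)
      k = spineBelow v
      evens odds : ℕ → ℕ
      evens j = isEven (parity (j + k))
      odds  j = isOdd (parity (j + k))

      leaf-neighbour : ∀ {x} → x ∈ leafNeighbours v → Leaf t x × v ∈ neighbours x
      leaf-neighbour x∈ = let (x∈N , leaf) = ∈-filter⁻ leaf? {xs = neighbours v} x∈ in leaf , neighbours-sym x∈N

      leaves : (f : Fin n → ℕ) (g : ℕ → ℕ) → (∀ {x} → Leaf t x → v ∈ neighbours x → f x ≡ g (indexOf x (leafNeighbours v))) →
               ∑ (leafNeighbours v) f ≡ ∑< m g
      leaves f g f≡g = trans (∑-cong (leafNeighbours v) (λ x∈ → let (leaf , v∈x) = leaf-neighbour x∈ in f≡g leaf v∈x))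
                             (∑-indexOf g (leafNeighbours-unique v))

    below-spine : below v ≡ ∑< m evens + spineBelow v
    below-spine = trans (∑-partition leaf? (neighbours v) (λ x → 𝟙 (x ≺? v))) (cong₂ _+_
      (leaves _ evens (λ leaf v∈x → trans (proj₁ (𝟙-≺-leaf v∈ leaf v∈x)) (cong isEven (leafParity-at leaf v∈x))))
      (∑-cong (spineNeighbours v) (λ x∈ → let (x∈N , x∈sp) = spine-neighbour x∈ in 𝟙-≺-spine x∈sp v∈ (neighbours-≢ x∈N ∘ sym))))

    above-spine : above v ≡ ∑< m odds + spineAbove v
    above-spine = trans (∑-partition leaf? (neighbours v) (λ x → 𝟙 (v ≺? x))) (cong₂ _+_
      (leaves _ odds (λ leaf v∈x → trans (proj₂ (𝟙-≺-leaf v∈ leaf v∈x)) (cong isOdd (leafParity-at leaf v∈x))))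
      (∑-cong (spineNeighbours v) (λ x∈ → let (x∈N , x∈sp) = spine-neighbour x∈ in 𝟙-≺-spine v∈ x∈sp (neighbours-≢ x∈N))))

    spineBelow≤1 : spineBelow v ≤ 1
    spineBelow≤1 = ∑-≤-1 _≟_ _ (spineNeighbours-unique v) (λ {x} _ → 𝟙-≤-1 (spine-index x <? spine-index v))
      (λ x∈ y∈ fx fy → indexOf-injective (proj₂ (spine-neighbour y∈))
        (suc-injective (trans (sym (predecessor x∈ (𝟙≢0⇒ _ fx))) (predecessor y∈ (𝟙≢0⇒ _ fy)))))
      where
        predecessor : ∀ {x} → x ∈ spineNeighbours v → spine-index x < spine-index v → spine-index v ≡ suc (spine-index x)
        predecessor x∈ x<v with spine-adjacent v∈ (proj₂ (spine-neighbour x∈)) (proj₁ (spine-neighbour x∈))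
        ... | inj₁ x≡1+v = ⊥-elim (<-asym x<v (≤-reflexive (sym x≡1+v)))
        ... | inj₂ v≡1+x = v≡1+x

    spineAbove≤1 : spineAbove v ≤ 1
    spineAbove≤1 = ∑-≤-1 _≟_ _ (spineNeighbours-unique v) (λ {x} _ → 𝟙-≤-1 (spine-index v <? spine-index x))
      (λ x∈ y∈ fx fy → indexOf-injective (proj₂ (spine-neighbour y∈))
        (trans (successor x∈ (𝟙≢0⇒ _ fx)) (sym (successor y∈ (𝟙≢0⇒ _ fy)))))
      where
        successor : ∀ {x} → x ∈ spineNeighbours v → spine-index v < spine-index x → spine-index x ≡ suc (spine-index v)
        successor x∈ v<x with spine-adjacent v∈ (proj₂ (spine-neighbour x∈)) (proj₁ (spine-neighbour x∈))
        ... | inj₁ x≡1+v = x≡1+v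
        ... | inj₂ v≡1+x = ⊥-elim (<-asym v<x (≤-reflexive (sym v≡1+x)))

    balanced-spine : Balanced (below v) (above v)
    balanced-spine = subst (Balanced (below v)) (trans (+-comm (spineAbove v) (∑< m odds)) (sym above-spine))
      (Balanced-+ below-alternates (isOdd≤1 (parity (m + k))) spineAbove≤1)
      where
        below-alternates : below v ≡ ∑< m odds + isOdd (parity (m + k))
        below-alternates = begin
          below v                              ≡⟨ below-spine ⟩
          ∑< m evens + k                       ≡⟨ cong (∑< m evens +_) (isOdd-parity spineBelow≤1) ⟨
          ∑< m evens + isOdd (parity k)        ≡⟨ alternation m k ⟩
          ∑< m odds + isOdd (parity (m + k))   ∎
          where open ≡-Reasoning

  balanced : ∀ v → Balanced (below v) (above v)
  balanced v = by-kind (leaf? v)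
    where
      by-kind : Dec (Leaf t v) → Balanced (below v) (above v)
      by-kind (yes leaf)  = +≡1⇒Balanced (trans (below+above≡degree v) (length-neighbours-leaf leaf))
      by-kind (no  ¬leaf) = balanced-spine (¬Leaf⇒∈spine ¬leaf)

  open Positions arrangement using (pos)

  intervals-covered : Cost.IntervalsCovered (edges t) (simple t) arrangement
  intervals-covered v∈u pu<pw pw<pv = ≺-covered v∈u (pos<⇒≺ pu<pw) (pos<⇒≺ pw<pv)

  balanced-at : ∀ v → Cost.BalancedAt (edges t) (simple t) arrangement v
  balanced-at v = subst₂ Balanced (sym left≡below) (sym right≡above) (balanced v)
    where
      left≡below : left (pos v) (map pos (neighbours v)) ≡ below v
      left≡below = trans (∑-map (neighbours v) pos (λ y → 𝟙 (y <? pos v)))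
                         (∑-cong (neighbours v) (λ {x} _ → 𝟙-cong (pos x <? pos v) (x ≺? v) pos<⇒≺ ≺⇒pos<))
      right≡above : right (pos v) (map pos (neighbours v)) ≡ above v
      right≡above = trans (∑-map (neighbours v) pos (λ y → 𝟙 (pos v <? y)))
                          (∑-cong (neighbours v) (λ {x} _ → 𝟙-cong (pos v <? pos x) (v ≺? x) pos<⇒≺ ≺⇒pos<))

caterpillar-IsDmin : ∀ {n} (t : Tree n) → IsCaterpillar t →
                     IsDmin t (length (edges t) + ∑ (allFin n) (quarterSquare ∘ degree t))
caterpillar-IsDmin {n} t cat = (arrangement , ≤-antisym optimal (lower-bound arrangement)) , lower-bound
  where
    open CaterpillarArrangement t cat
    open Cost (edges t) (simple t) using (cost≡edges+gaps; gap; quarterSquares≤gaps; gaps≤quarterSquares)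
    m = length (edges t)
    Q = ∑ (allFin n) (quarterSquare ∘ degree t)
    Q≡ : Q ≡ ∑ (allFin n) (quarterSquare ∘ length ∘ neighbours)
    Q≡ = ∑-cong (allFin n) (λ {v} _ → cong quarterSquare (degree≡length-neighbours v))
    lower-bound : ∀ π → m + Q ≤ D t π
    lower-bound π = begin
      m + Q                        ≤⟨ +-monoʳ-≤ m (subst (_≤ ∑ (edges t) (gap π)) (sym Q≡) (quarterSquares≤gaps π no-triangle)) ⟩
      m + ∑ (edges t) (gap π)      ≡⟨ cost≡edges+gaps π ⟨
      D t π                        ∎
      where open ≤-Reasoning
    optimal : D t arrangement ≤ m + Q
    optimal = begin
      D t arrangement              ≡⟨ cost≡edges+gaps arrangement ⟩
      m + ∑ (edges t) (gap arrangement)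
        ≤⟨ +-monoʳ-≤ m (subst (∑ (edges t) (gap arrangement) ≤_) (sym Q≡)
                              (gaps≤quarterSquares arrangement intervals-covered balanced-at)) ⟩
      m + Q                        ∎
      where open ≤-Reasoning

module _ {n : ℕ} (t : Tree n) where

  open TreeGraph t using (∑-degree)

  private
    m = length (edges t)
    Q = ∑ (allFin n) (quarterSquare ∘ degree t)

  sumDeg-⌊[k∸1]²/4⌋ : sumDeg t (λ k → ((k ∸ 1) ^ 2) / 4) ≡ Q
  sumDeg-⌊[k∸1]²/4⌋ = ∑-cong (allFin n) (λ {v} _ → ⌊[k∸1]²/4⌋≡quarterSquare (degree t v))

  sumDeg-⌊[k+1]²/4⌋ : sumDeg t (λ k → ((k + 1) ^ 2) / 4) ≡ Q + 2 * m
  sumDeg-⌊[k+1]²/4⌋ = begin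
    sumDeg t (λ k → ((k + 1) ^ 2) / 4)           ≡⟨ ∑-cong (allFin n) (λ {v} _ → ⌊[k+1]²/4⌋≡quarterSquare+k (degree t v)) ⟩
    ∑ (allFin n) (λ v → quarterSquare (degree t v) + degree t v)
                                                 ≡⟨ ∑-distrib-+ (allFin n) (quarterSquare ∘ degree t) (degree t) ⟩
    Q + ∑ (allFin n) (degree t)                  ≡⟨ cong (Q +_) ∑-degree ⟩
    Q + 2 * m                                    ∎
    where open ≡-Reasoning

  sumDeg-⌊[k+1]²/4⌋∸edges : sumDeg t (λ k → ((k + 1) ^ 2) / 4) ∸ m ≡ m + Q
  sumDeg-⌊[k+1]²/4⌋∸edges = begin
    sumDeg t (λ k → ((k + 1) ^ 2) / 4) ∸ m    ≡⟨ cong (_∸ m) sumDeg-⌊[k+1]²/4⌋ ⟩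
    (Q + 2 * m) ∸ m                           ≡⟨ cong (_∸ m) (trans (cong (Q +_) (2*m≡m+m m)) (sym (+-assoc Q m m))) ⟩
    (Q + m + m) ∸ m                           ≡⟨ m+n∸n≡m (Q + m) m ⟩
    Q + m                                     ≡⟨ +-comm Q m ⟩
    m + Q                                     ∎
    where
      open ≡-Reasoning
      2*m≡m+m : ∀ m → 2 * m ≡ m + m
      2*m≡m+m = solve-∀

  sumDeg-squares+parities : sumDeg t (λ k → k ^ 2) + sumDeg t (λ k → k % 2) ≡ 4 * (m + Q)
  sumDeg-squares+parities = begin
    sumDeg t (λ k → k ^ 2) + sumDeg t (λ k → k % 2)
      ≡⟨ ∑-distrib-+ (allFin n) (λ v → degree t v ^ 2) (λ v → degree t v % 2) ⟨
    ∑ (allFin n) (λ v → degree t v ^ 2 + degree t v % 2)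
      ≡⟨ ∑-cong (allFin n) (λ {v} _ → 4*quarterSquare+2k≡k²+parity (degree t v)) ⟨
    ∑ (allFin n) (λ v → 4 * quarterSquare (degree t v) + 2 * degree t v)
      ≡⟨ ∑-distrib-+ (allFin n) (λ v → 4 * quarterSquare (degree t v)) (λ v → 2 * degree t v) ⟩
    ∑ (allFin n) (λ v → 4 * quarterSquare (degree t v)) + ∑ (allFin n) (λ v → 2 * degree t v)
      ≡⟨ cong₂ _+_ (∑-*-distribˡ (allFin n) 4 (quarterSquare ∘ degree t)) (∑-*-distribˡ (allFin n) 2 (degree t)) ⟩
    4 * Q + 2 * ∑ (allFin n) (degree t)
      ≡⟨ cong (λ d → 4 * Q + 2 * d) ∑-degree ⟩
    4 * Q + 2 * (2 * m)
      ≡⟨ regroup m Q ⟩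
    4 * (m + Q) ∎
    where
      open ≡-Reasoning
      regroup : ∀ m Q → 4 * Q + 2 * (2 * m) ≡ 4 * (m + Q)
      regroup = solve-∀

theorem4 : ∀ (n : ℕ) (t : Tree n) → IsCaterpillar t →
    IsDmin t ((n ∸ 1) + sumDeg t (λ k → ((k ∸ 1) ^ 2) / 4))
    × ((n ∸ 1) + sumDeg t (λ k → ((k ∸ 1) ^ 2) / 4)
        ≡ sumDeg t (λ k → ((k + 1) ^ 2) / 4) ∸ (n ∸ 1))
    × (4 * ((n ∸ 1) + sumDeg t (λ k → ((k ∸ 1) ^ 2) / 4))
        ≡ sumDeg t (λ k → k ^ 2) + sumDeg t (λ k → k % 2))
theorem4 n t cat =
  subst (IsDmin t) (sym value≡) (caterpillar-IsDmin t cat) ,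
  trans value≡ (sym (subst (λ d → sumDeg t (λ k → ((k + 1) ^ 2) / 4) ∸ d ≡ m + Q) (sym n∸1≡m)
                           (sumDeg-⌊[k+1]²/4⌋∸edges t))) ,
  trans (cong (4 *_) value≡) (sym (sumDeg-squares+parities t))
  where
    m = length (edges t)
    Q = ∑ (allFin n) (quarterSquare ∘ degree t)
    n∸1≡m : n ∸ 1 ≡ m
    n∸1≡m = cong (_∸ 1) (sym (size t))
    value≡ : (n ∸ 1) + sumDeg t (λ k → ((k ∸ 1) ^ 2) / 4) ≡ m + Q
    value≡ = cong₂ _+_ n∸1≡m (sumDeg-⌊[k∸1]²/4⌋ t)
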